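{- For every acute walled wedge whose induced subgraph of the grid is connected, there exists a finite deterministic automaton that explores it without pebbles (i.e., with $p=0$).
   Context: The oriented grid $\mathbb{Z}\times\mathbb{Z}$ is embedded in the plane (nodes at integer points, edges between nodes at distance 1); nodes are anonymous and every node has ports $N,E,S,W$ pointing North, East, South, West. Given two half-lines $H_1,H_2$ in the plane with a common origin $O$ (an arbitrary point; arbitrary real directions), let $W(H_1,H_2)$ be the closed region swept clockwise from $H_1$ to $H_2$ (half-lines included); the wedge is the subgraph of the grid induced by the grid nodes in $W(H_1,H_2)$. It is acute if the clockwise angle from $H_1$ to $H_2$ is less than $\pi/2$. A boundary $H_i$ is a wall if for every grid edge $\{u,v\}$ with $u$ in the wedge, $v$ not in the wedge and $H_i$ meeting the closed segment $[u,v]$, the ports of this edge at $u$ and at $v$ are blocked (cannot be taken); all other ports are free. A wedge is walled if both boundaries are walls. The agent is a finite deterministic (Mealy) automaton carrying $p$ pebbles: at each step it sees which ports at the current node are free, whether a pebble lies there, and how many pebbles it carries; depending on its state and this input it moves through a free port, possibly dropping or picking up a pebble, and changes state. It starts in its initial state at an adversarially chosen node of the wedge. The automaton (which may depend on $H_1,H_2$ but not on the starting node) explores the wedge if for every starting node every node of the wedge is eventually visited. -}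

module Defs where

open import Level using (0ℓ)
open import Data.Nat using (ℕ; zero; suc)
open import Data.Integer as ℤ using (ℤ; +_; -[1+_])
open import Data.Fin using (Fin)
open import Data.Bool using (Bool; true; false; if_then_else_)
open import Data.Product using (Σ; ∃; ∃-syntax; _×_; _,_; proj₁; proj₂)
open import Data.Sum using (_⊎_)
open import Data.Empty using (⊥)
open import Relation.Nullary using (¬_; Dec; does)
open import Relation.Binary.PropositionalEquality using (_≡_; _≢_)
open import Relation.Binary.Core using (Rel)
open import Relation.Binary.Structures using (IsStrictTotalOrder)
open import Algebra.Core using (Op₁; Op₂)
open import Algebra.Structures using (IsCommutativeRing)
open import Axiom.ExcludedMiddle using (ExcludedMiddle)

-- The real numbers, axiomatised as a Dedekind-complete ordered field
-- (unique up to isomorphism, so quantifying over all of them is the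
-- same as working in ℝ).

record RealField : Set₁ where
  infixl 6 _+_
  infixl 7 _*_
  infix 4 _<_ _≤_
  field
    Carrier : Set
    _+_ _*_ : Op₂ Carrier
    -_      : Op₁ Carrier
    0# 1#   : Carrier
    isCommutativeRing : IsCommutativeRing _≡_ _+_ _*_ -_ 0# 1#
    0≢1     : 0# ≢ 1#
    inverse : ∀ x → x ≢ 0# → ∃[ y ] (x * y ≡ 1#)
    _<_     : Rel Carrier 0ℓ
    isStrictTotalOrder : IsStrictTotalOrder _≡_ _<_
    +-mono-< : ∀ {x y} z → x < y → x + z < y + z
    *-pos    : ∀ {x y} → 0# < x → 0# < y → 0# < x * y

  _≤_ : Rel Carrier 0ℓ
  x ≤ y = x < y ⊎ x ≡ y

  _-_ : Op₂ Carrier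
  x - y = x + (- y)

  field
    lub : (P : Carrier → Set) → ∃ P → (∃[ b ] (∀ x → P x → x ≤ b)) →
          ∃[ s ] ((∀ x → P x → x ≤ s) × (∀ b → (∀ x → P x → x ≤ b) → s ≤ b))

Node : Set
Node = ℤ × ℤ

data Port : Set where
  N E S W : Port

go : Port → Node → Node
go N (x , y) = x , y ℤ.+ ℤ.1ℤ
go E (x , y) = x ℤ.+ ℤ.1ℤ , y
go S (x , y) = x , y ℤ.- ℤ.1ℤ
go W (x , y) = x ℤ.- ℤ.1ℤ , y

module _ (ℝ : RealField) where
  open RealField ℝ

  Point : Set
  Point = Carrier × Carrier

  fromℕ : ℕ → Carrier
  fromℕ zero    = 0#
  fromℕ (suc n) = 1# + fromℕ n

  fromℤ : ℤ → Carrier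
  fromℤ (+ n)     = fromℕ n
  fromℤ -[1+ n ]  = - (1# + fromℕ n)

  embed : Node → Point
  embed (x , y) = fromℤ x , fromℤ y

  NonZeroVec : Point → Set
  NonZeroVec (a , b) = ¬ (a ≡ 0# × b ≡ 0#)

  cross : Point → Point → Carrier
  cross (a , b) (c , d) = a * d - b * c

  dot : Point → Point → Carrier
  dot (a , b) (c , d) = a * c + b * d

  -- The clockwise angle from direction d₁ to direction d₂ lies in [0, π/2).
  Acute : Point → Point → Set
  Acute d₁ d₂ = (cross d₁ d₂ ≤ 0#) × (0# < dot d₁ d₂)

  -- A wedge: origin O, direction of H₁, direction of H₂.
  -- (For an acute wedge the region W(H₁,H₂) is the convex cone
  --  O + {a·d₁ + b·d₂ | a, b ≥ 0}.)
  InRegion : Point → Point → Point → Point → Set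
  InRegion (ox , oy) (ux , uy) (vx , vy) (px , py) =
    ∃[ a ] ∃[ b ] (0# ≤ a × 0# ≤ b ×
      px ≡ ox + (a * ux + b * vx) × py ≡ oy + (a * uy + b * vy))

  InWedge : Point → Point → Point → Node → Set
  InWedge O d₁ d₂ u = InRegion O d₁ d₂ (embed u)

  MeetsSegment : Point → Point → Node → Node → Set
  MeetsSegment (ox , oy) (dx , dy) u v =
    let (ux , uy) = embed u ; (vx , vy) = embed v in
    ∃[ t ] ∃[ s ] (0# ≤ t × 0# ≤ s × s ≤ 1# ×
      ox + t * dx ≡ ux + s * (vx - ux) × oy + t * dy ≡ uy + s * (vy - uy))

  -- Both boundaries are walls: the port p at node u is blocked iff the edge
  -- {u, go p u} has exactly one endpoint in the wedge and H₁ or H₂ meets it.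
  Blocked : Point → Point → Point → Node → Port → Set
  Blocked O d₁ d₂ u p =
    let v = go p u in
    ((InWedge O d₁ d₂ u × ¬ InWedge O d₁ d₂ v) ⊎ (InWedge O d₁ d₂ v × ¬ InWedge O d₁ d₂ u))
    × (MeetsSegment O d₁ u v ⊎ MeetsSegment O d₂ u v)

  Free : Point → Point → Point → Node → Port → Set
  Free O d₁ d₂ u p = ¬ Blocked O d₁ d₂ u p

  data Reach (O d₁ d₂ : Point) : Node → Node → Set where
    here : ∀ {u} → InWedge O d₁ d₂ u → Reach O d₁ d₂ u u
    step : ∀ {u w} (p : Port) → InWedge O d₁ d₂ u →
           Reach O d₁ d₂ (go p u) w → Reach O d₁ d₂ u w

  Connected : Point → Point → Point → Set
  Connected O d₁ d₂ = ∀ u v → InWedge O d₁ d₂ u → InWedge O d₁ d₂ v → Reach O d₁ d₂ u v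

-- Input at a node: which ports are free (pebble information is constant
-- when p = 0 and is omitted).

record Automaton : Set where
  field
    size  : ℕ
    init  : Fin size
    δ     : Fin size → (Port → Bool) → Port × Fin size

module _ (ℝ : RealField) (lem : ExcludedMiddle 0ℓ) (O d₁ d₂ : Point ℝ) where

  freeBits : Node → Port → Bool
  freeBits u p = does (lem {Free ℝ O d₁ d₂ u p})

  -- The automaton only ever chooses a port; if it is not free the agent
  -- stays (an automaton can always avoid this, since it sees freeBits).
  run : (A : Automaton) → Node → ℕ → Fin (Automaton.size A) × Node
  run A u zero = Automaton.init A , u
  run A u (suc n) =
    let (q , x) = run A u n
        (p , q′) = Automaton.δ A q (freeBits x)
    in q′ , (if freeBits x p then go p x else x)

  Explores : Automaton → Set
  Explores A = ∀ u v → InWedge ℝ O d₁ d₂ u → InWedge ℝ O d₁ d₂ v →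
               ∃[ n ] (proj₂ (run A u n) ≡ v)

{-# OPTIONS --safe #-}

-- Both half-lines are walls and the wedge is convex, so an edge leaving the wedge crosses
-- H₁ or H₂: at a node of the wedge a port is free exactly when the neighbour lies in the
-- wedge.  As d₁·d₂ > 0, one of the four axis directions ε has ε·d₁ > 0 and ε·d₂ > 0.
-- Taking columns orthogonal to ε, the wedge meets every column in a finite interval (the
-- other coordinate is dominated by the ε-coordinate) and it has a hindmost column
-- (ε·p ≥ ε·O).  A five-state automaton explores such a region: it retreats to the
-- hindmost column by walking down a column and climbing it until a backward edge
-- appears, and then sweeps every column from top to bottom, stepping forward through the
-- lowest forward edge.  Connectivity guarantees that the retreat ends in the hindmost
-- column and that the sweep reaches every column.

module Submission where

open import Defs
open import Level using (0ℓ)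
open import Data.Nat as ℕ using (zero; suc)
import Data.Nat.Properties as ℕ
open import Data.Integer as ℤ using (ℤ; -[1+_]; _⊖_)
import Data.Integer.Properties as ℤ
open import Data.Product using (∃-syntax; _×_; _,_; proj₁; proj₂)
open import Data.Sum as Sum using (_⊎_; inj₁; inj₂)
open import Data.Empty using (⊥-elim)
open import Data.Maybe using (map)
open import Relation.Nullary using (¬_; yes; no)
open import Relation.Nullary.Decidable using (dec⇒maybe; dec-true; dec-false)
open import Relation.Binary.PropositionalEquality
open import Relation.Binary.Bundles using (StrictPartialOrder)
open import Relation.Binary.Definitions using (tri<; tri≈; tri>)
open import Relation.Binary.Structures using (IsStrictTotalOrder)
import Relation.Binary.Reasoning.StrictPartialOrder as StrictReasoning
open import Algebra.Bundles using (CommutativeRing)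
open import Algebra.Structures using (IsCommutativeRing)
import Algebra.Properties.Ring as RingProperties
import Algebra.Solver.Ring
open import Algebra.Solver.Ring.AlmostCommutativeRing
  using (fromCommutativeRing; _-Raw-AlmostCommutative⟶_)
open import Axiom.ExcludedMiddle using (ExcludedMiddle)
open import Axiom.DoubleNegationElimination using (em⇒dne)
open import Data.Nat.GeneralisedArithmetic using (fold; iterate; iterate-is-fold)
open import Data.Integer.Tactic.RingSolver using (solve-∀)
open import Data.Bool using (Bool; true; false; if_then_else_)
open import Data.Fin using (Fin; zero; suc)
open import Function using (_∘_)
open import Relation.Binary.Construct.Closure.ReflexiveTransitive using (Star; ε; _◅_; _◅◅_)

module RealFieldProperties (ℝ : RealField) where
  open RealField ℝ
  open IsCommutativeRing isCommutativeRing
    using (+-assoc; +-comm; +-identityˡ; +-identityʳ; *-comm; *-identityˡ; *-identityʳ;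
           zeroˡ; zeroʳ; -‿inverseʳ; distribʳ) public
  open IsStrictTotalOrder isStrictTotalOrder
    using (compare) renaming (trans to <-trans; asym to <-asym) public

  commutativeRing : CommutativeRing 0ℓ 0ℓ
  commutativeRing = record { isCommutativeRing = isCommutativeRing }

  open RingProperties (CommutativeRing.ring commutativeRing)
    using (-‿involutive; -0#≈0#; -‿distribˡ-*; -‿distribʳ-*; -‿+-comm) public

  fromℕ-+ : ∀ m n → fromℕ ℝ (m ℕ.+ n) ≡ fromℕ ℝ m + fromℕ ℝ n
  fromℕ-+ zero    n = sym (+-identityˡ _)
  fromℕ-+ (suc m) n = trans (cong (1# +_) (fromℕ-+ m n)) (sym (+-assoc _ _ _))

  fromℕ-* : ∀ m n → fromℕ ℝ (m ℕ.* n) ≡ fromℕ ℝ m * fromℕ ℝ n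
  fromℕ-* zero    n = sym (zeroˡ _)
  fromℕ-* (suc m) n = begin
    fromℕ ℝ (n ℕ.+ m ℕ.* n)                 ≡⟨ fromℕ-+ n (m ℕ.* n) ⟩
    fromℕ ℝ n + fromℕ ℝ (m ℕ.* n)           ≡⟨ cong₂ _+_ (sym (*-identityˡ _)) (fromℕ-* m n) ⟩
    1# * fromℕ ℝ n + fromℕ ℝ m * fromℕ ℝ n  ≡⟨ sym (distribʳ _ _ _) ⟩
    (1# + fromℕ ℝ m) * fromℕ ℝ n            ∎
    where open ≡-Reasoning

  fromℤ-⊖ : ∀ m n → fromℤ ℝ (m ⊖ n) ≡ fromℕ ℝ m - fromℕ ℝ n
  fromℤ-⊖ m       zero    = begin
    fromℤ ℝ (m ⊖ 0)   ≡⟨ cong (fromℤ ℝ) (ℤ.⊖-≥ {m} ℕ.z≤n) ⟩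
    fromℕ ℝ m         ≡⟨ sym (+-identityʳ _) ⟩
    fromℕ ℝ m + 0#    ≡⟨ cong (fromℕ ℝ m +_) (sym -0#≈0#) ⟩
    fromℕ ℝ m - 0#    ∎
    where open ≡-Reasoning
  fromℤ-⊖ zero    (suc n) = sym (+-identityˡ _)
  fromℤ-⊖ (suc m) (suc n) = begin
    fromℤ ℝ (suc m ⊖ suc n)                        ≡⟨ cong (fromℤ ℝ) (ℤ.[1+m]⊖[1+n]≡m⊖n m n) ⟩
    fromℤ ℝ (m ⊖ n)                                ≡⟨ fromℤ-⊖ m n ⟩
    fromℕ ℝ m + - fromℕ ℝ n                        ≡⟨ cong (_+ - fromℕ ℝ n) (sym (+-identityˡ _)) ⟩
    (0# + fromℕ ℝ m) + - fromℕ ℝ n                 ≡⟨ cong (λ z → (z + fromℕ ℝ m) + - fromℕ ℝ n)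
                                                          (sym (-‿inverseʳ 1#)) ⟩
    ((1# + - 1#) + fromℕ ℝ m) + - fromℕ ℝ n        ≡⟨ cong (_+ - fromℕ ℝ n) (swap-middle 1# (- 1#) (fromℕ ℝ m)) ⟩
    ((1# + fromℕ ℝ m) + - 1#) + - fromℕ ℝ n        ≡⟨ +-assoc _ _ _ ⟩
    (1# + fromℕ ℝ m) + (- 1# + - fromℕ ℝ n)        ≡⟨ cong ((1# + fromℕ ℝ m) +_) (-‿+-comm 1# (fromℕ ℝ n)) ⟩
    (1# + fromℕ ℝ m) - (1# + fromℕ ℝ n)            ∎
    where
    open ≡-Reasoning
    swap-middle : ∀ a b c → (a + b) + c ≡ (a + c) + b
    swap-middle a b c = trans (+-assoc a b c) (trans (cong (a +_) (+-comm b c)) (sym (+-assoc a c b)))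

  fromℤ-+ : ∀ i j → fromℤ ℝ (i ℤ.+ j) ≡ fromℤ ℝ i + fromℤ ℝ j
  fromℤ-+ (ℤ.+ m)    (ℤ.+ n)    = fromℕ-+ m n
  fromℤ-+ (ℤ.+ m)    -[1+ n ] = fromℤ-⊖ m (suc n)
  fromℤ-+ -[1+ m ] (ℤ.+ n)    = trans (fromℤ-⊖ n (suc m)) (+-comm _ _)
  fromℤ-+ -[1+ m ] -[1+ n ] = begin
    - fromℕ ℝ (suc (suc (m ℕ.+ n)))               ≡⟨ cong (λ k → - fromℕ ℝ (suc k)) (sym (ℕ.+-suc m n)) ⟩
    - fromℕ ℝ (suc m ℕ.+ suc n)                   ≡⟨ cong -_ (fromℕ-+ (suc m) (suc n)) ⟩
    - (fromℕ ℝ (suc m) + fromℕ ℝ (suc n))         ≡⟨ sym (-‿+-comm _ _) ⟩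
    - fromℕ ℝ (suc m) + - fromℕ ℝ (suc n)         ∎
    where open ≡-Reasoning

  fromℤ-neg : ∀ i → fromℤ ℝ (ℤ.- i) ≡ - fromℤ ℝ i
  fromℤ-neg (ℤ.+ zero)  = sym -0#≈0#
  fromℤ-neg (ℤ.+ suc n) = refl
  fromℤ-neg -[1+ n ]  = sym (-‿involutive _)

  fromℤ-+* : ∀ m j → fromℤ ℝ (ℤ.+ m ℤ.* j) ≡ fromℕ ℝ m * fromℤ ℝ j
  fromℤ-+* m (ℤ.+ n)    = trans (cong (fromℤ ℝ) (sym (ℤ.pos-* m n))) (fromℕ-* m n)
  fromℤ-+* m -[1+ n ] = begin
    fromℤ ℝ (ℤ.+ m ℤ.* ℤ.- ℤ.+ suc n)      ≡⟨ cong (fromℤ ℝ) (sym (ℤ.neg-distribʳ-* (ℤ.+ m) (ℤ.+ suc n))) ⟩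
    fromℤ ℝ (ℤ.- (ℤ.+ m ℤ.* ℤ.+ suc n))    ≡⟨ fromℤ-neg (ℤ.+ m ℤ.* ℤ.+ suc n) ⟩
    - fromℤ ℝ (ℤ.+ m ℤ.* ℤ.+ suc n)        ≡⟨ cong -_ (fromℤ-+* m (ℤ.+ suc n)) ⟩
    - (fromℕ ℝ m * fromℕ ℝ (suc n))    ≡⟨ -‿distribʳ-* _ _ ⟩
    fromℕ ℝ m * - fromℕ ℝ (suc n)      ∎
    where open ≡-Reasoning

  fromℤ-* : ∀ i j → fromℤ ℝ (i ℤ.* j) ≡ fromℤ ℝ i * fromℤ ℝ j
  fromℤ-* (ℤ.+ m)    j = fromℤ-+* m j
  fromℤ-* -[1+ m ] j = begin
    fromℤ ℝ (ℤ.- ℤ.+ suc m ℤ.* j)       ≡⟨ cong (fromℤ ℝ) (sym (ℤ.neg-distribˡ-* (ℤ.+ suc m) j)) ⟩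
    fromℤ ℝ (ℤ.- (ℤ.+ suc m ℤ.* j))     ≡⟨ fromℤ-neg (ℤ.+ suc m ℤ.* j) ⟩
    - fromℤ ℝ (ℤ.+ suc m ℤ.* j)         ≡⟨ cong -_ (fromℤ-+* (suc m) j) ⟩
    - (fromℕ ℝ (suc m) * fromℤ ℝ j)   ≡⟨ -‿distribˡ-* _ _ ⟩
    - fromℕ ℝ (suc m) * fromℤ ℝ j     ∎
    where open ≡-Reasoning

  -- fromℤ up to sending 1 and -1 to 1# and - 1# on the nose, so that the
  -- constants of solver equations are the field's own 1# and - 1#
  ι : ℤ → Carrier
  ι (ℤ.+ 1)   = 1#
  ι -[1+ 0 ]  = - 1#
  ι i         = fromℤ ℝ i

  fromℤ≗ι : ∀ i → fromℤ ℝ i ≡ ι i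
  fromℤ≗ι (ℤ.+ 0)           = refl
  fromℤ≗ι (ℤ.+ 1)           = +-identityʳ 1#
  fromℤ≗ι (ℤ.+ suc (suc n)) = refl
  fromℤ≗ι -[1+ 0 ]          = cong -_ (+-identityʳ 1#)
  fromℤ≗ι -[1+ suc n ]      = refl

  ι-homomorphism : CommutativeRing.rawRing ℤ.+-*-commutativeRing
                     -Raw-AlmostCommutative⟶ fromCommutativeRing commutativeRing
  ι-homomorphism = record
    { ⟦_⟧    = ι
    ; +-homo = λ i j → transport _+_ i j (i ℤ.+ j) (fromℤ-+ i j)
    ; *-homo = λ i j → transport _*_ i j (i ℤ.* j) (fromℤ-* i j)
    ; -‿homo = λ i → trans (sym (fromℤ≗ι (ℤ.- i))) (trans (fromℤ-neg i) (cong -_ (fromℤ≗ι i)))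
    ; 0-homo = refl
    ; 1-homo = refl
    }
    where
    transport : ∀ (_∙_ : Carrier → Carrier → Carrier) i j k →
                fromℤ ℝ k ≡ fromℤ ℝ i ∙ fromℤ ℝ j → ι k ≡ ι i ∙ ι j
    transport _∙_ i j k e =
      trans (sym (fromℤ≗ι k)) (trans e (cong₂ _∙_ (fromℤ≗ι i) (fromℤ≗ι j)))

  module Solver = Algebra.Solver.Ring _ _ ι-homomorphism
    (λ i j → map (cong ι) (dec⇒maybe (i ℤ.≟ j)))
  open Solver public using (solve; _:=_; _:+_; _:*_; :-_; _:-_)

  con0 con1 : ∀ {n} → Solver.Polynomial n
  con0 = Solver.con (ℤ.+ 0)
  con1 = Solver.con (ℤ.+ 1)

  <-strictPartialOrder : StrictPartialOrder 0ℓ 0ℓ 0ℓ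
  <-strictPartialOrder = record
    { isStrictPartialOrder = IsStrictTotalOrder.isStrictPartialOrder isStrictTotalOrder }

  module ≤-Reasoning = StrictReasoning <-strictPartialOrder

  <-irrefl : ∀ {x} → ¬ x < x
  <-irrefl = IsStrictTotalOrder.irrefl isStrictTotalOrder refl

  ≤-refl : ∀ {x} → x ≤ x
  ≤-refl = inj₂ refl

  <-≤-trans : ∀ {x y z} → x < y → y ≤ z → x < z
  <-≤-trans p (inj₁ q)    = <-trans p q
  <-≤-trans p (inj₂ refl) = p

  ≤-<-trans : ∀ {x y z} → x ≤ y → y < z → x < z
  ≤-<-trans (inj₁ p)    q = <-trans p q
  ≤-<-trans (inj₂ refl) q = q

  ≤-trans : ∀ {x y z} → x ≤ y → y ≤ z → x ≤ z
  ≤-trans (inj₁ p)    q = inj₁ (<-≤-trans p q)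
  ≤-trans (inj₂ refl) q = q

  ≤⇒≯ : ∀ {x y} → x ≤ y → ¬ y < x
  ≤⇒≯ (inj₁ p)    q = <-asym p q
  ≤⇒≯ (inj₂ refl) q = <-irrefl q

  ≮⇒≥ : ∀ {x y} → ¬ x < y → y ≤ x
  ≮⇒≥ {x} {y} x≮y with compare x y
  ... | tri< x<y _   _   = ⊥-elim (x≮y x<y)
  ... | tri≈ _   x≡y _   = inj₂ (sym x≡y)
  ... | tri> _   _   y<x = inj₁ y<x

  ≤-antisym : ∀ {x y} → x ≤ y → y ≤ x → x ≡ y
  ≤-antisym (inj₂ x≡y) _ = x≡y
  ≤-antisym (inj₁ x<y) y≤x = ⊥-elim (≤⇒≯ y≤x x<y)

  ≤-total : ∀ x y → x ≤ y ⊎ y ≤ x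
  ≤-total x y with compare x y
  ... | tri< x<y _   _   = inj₁ (inj₁ x<y)
  ... | tri≈ _   x≡y _   = inj₁ (inj₂ x≡y)
  ... | tri> _   _   y<x = inj₂ (inj₁ y<x)

  <0⊎0≤ : ∀ x → x < 0# ⊎ 0# ≤ x
  <0⊎0≤ x with compare x 0#
  ... | tri< x<0 _   _   = inj₁ x<0
  ... | tri≈ _   x≡0 _   = inj₂ (inj₂ (sym x≡0))
  ... | tri> _   _   0<x = inj₂ (inj₁ 0<x)

  0<⊎≤0 : ∀ x → 0# < x ⊎ x ≤ 0#
  0<⊎≤0 x with compare 0# x
  ... | tri< 0<x _   _   = inj₁ 0<x
  ... | tri≈ _   0≡x _   = inj₂ (inj₂ (sym 0≡x))
  ... | tri> _   _   x<0 = inj₂ (inj₁ x<0)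

  +-monoʳ-< : ∀ {x y} z → x < y → z + x < z + y
  +-monoʳ-< {x} {y} z p = subst₂ _<_ (+-comm x z) (+-comm y z) (+-mono-< z p)

  +-monoˡ-≤ : ∀ {x y} z → x ≤ y → x + z ≤ y + z
  +-monoˡ-≤ z (inj₁ p)    = inj₁ (+-mono-< z p)
  +-monoˡ-≤ z (inj₂ refl) = ≤-refl

  +-monoʳ-≤ : ∀ {x y} z → x ≤ y → z + x ≤ z + y
  +-monoʳ-≤ z (inj₁ p)    = inj₁ (+-monoʳ-< z p)
  +-monoʳ-≤ z (inj₂ refl) = ≤-refl

  +-mono-≤ : ∀ {x y u v} → x ≤ y → u ≤ v → x + u ≤ y + v
  +-mono-≤ {y = y} {u} x≤y u≤v = ≤-trans (+-monoˡ-≤ u x≤y) (+-monoʳ-≤ y u≤v)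

  x<y⇒0<y-x : ∀ {x y} → x < y → 0# < y - x
  x<y⇒0<y-x {x} p = subst (_< _) (-‿inverseʳ x) (+-mono-< (- x) p)

  0<y-x⇒x<y : ∀ {x y} → 0# < y - x → x < y
  0<y-x⇒x<y {x} {y} p = subst₂ _<_ (+-identityˡ x) (solve 2 (λ x y → (y :- x) :+ x := y) refl x y)
                          (+-mono-< x p)

  x≤y⇒0≤y-x : ∀ {x y} → x ≤ y → 0# ≤ y - x
  x≤y⇒0≤y-x (inj₁ p)        = inj₁ (x<y⇒0<y-x p)
  x≤y⇒0≤y-x {x} (inj₂ refl) = inj₂ (sym (-‿inverseʳ x))

  0≤y-x⇒x≤y : ∀ {x y} → 0# ≤ y - x → x ≤ y
  0≤y-x⇒x≤y (inj₁ p)            = inj₁ (0<y-x⇒x<y p)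
  0≤y-x⇒x≤y {x} {y} (inj₂ 0≡y-x) = inj₂ (begin
    x             ≡⟨ sym (+-identityˡ x) ⟩
    0# + x        ≡⟨ cong (_+ x) 0≡y-x ⟩
    (y - x) + x   ≡⟨ solve 2 (λ x y → (y :- x) :+ x := y) refl x y ⟩
    y             ∎)
    where open ≡-Reasoning

  neg-antimono-< : ∀ {x y} → x < y → - y < - x
  neg-antimono-< {x} {y} p = 0<y-x⇒x<y
    (subst (0# <_) (solve 2 (λ x y → y :- x := (:- x) :- (:- y)) refl x y) (x<y⇒0<y-x p))

  x<0⇒0<-x : ∀ {x} → x < 0# → 0# < - x
  x<0⇒0<-x p = subst (_< _) -0#≈0# (neg-antimono-< p)

  0<x⇒-x<0 : ∀ {x} → 0# < x → - x < 0#
  0<x⇒-x<0 p = subst (_ <_) -0#≈0# (neg-antimono-< p)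

  +-nonNeg : ∀ {x y} → 0# ≤ x → 0# ≤ y → 0# ≤ x + y
  +-nonNeg {x} {y} p q = ≤-trans q (subst (_≤ x + y) (+-identityˡ y) (+-monoˡ-≤ y p))

  +-pos-nonNeg : ∀ {x y} → 0# < x → 0# ≤ y → 0# < x + y
  +-pos-nonNeg {x} {y} p q = ≤-<-trans q (subst (_< x + y) (+-identityˡ y) (+-mono-< y p))

  *-nonNeg : ∀ {x y} → 0# ≤ x → 0# ≤ y → 0# ≤ x * y
  *-nonNeg (inj₁ p)        (inj₁ q)    = inj₁ (*-pos p q)
  *-nonNeg {x} (inj₁ _)    (inj₂ refl) = inj₂ (sym (zeroʳ x))
  *-nonNeg {y = y} (inj₂ refl) _       = inj₂ (sym (zeroˡ y))

  *-monoˡ-≤-nonNeg : ∀ {c x y} → 0# ≤ c → x ≤ y → c * x ≤ c * y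
  *-monoˡ-≤-nonNeg {c} {x} {y} 0≤c x≤y = 0≤y-x⇒x≤y
    (subst (0# ≤_) (solve 3 (λ c x y → c :* (y :- x) := c :* y :- c :* x) refl c x y)
      (*-nonNeg 0≤c (x≤y⇒0≤y-x x≤y)))

  *-monoʳ-≤-nonNeg : ∀ {c x y} → 0# ≤ c → x ≤ y → x * c ≤ y * c
  *-monoʳ-≤-nonNeg {c} {x} {y} 0≤c x≤y =
    subst₂ _≤_ (*-comm c x) (*-comm c y) (*-monoˡ-≤-nonNeg 0≤c x≤y)

  *-mono-≤-nonNeg : ∀ {x y u v} → 0# ≤ x → x ≤ y → u ≤ v → 0# ≤ v → x * u ≤ y * v
  *-mono-≤-nonNeg 0≤x x≤y u≤v 0≤v = ≤-trans (*-monoˡ-≤-nonNeg 0≤x u≤v) (*-monoʳ-≤-nonNeg 0≤v x≤y)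

  *-monoˡ-<-pos : ∀ {c x y} → 0# < c → x < y → c * x < c * y
  *-monoˡ-<-pos {c} {x} {y} 0<c x<y = 0<y-x⇒x<y
    (subst (0# <_) (solve 3 (λ c x y → c :* (y :- x) := c :* y :- c :* x) refl c x y)
      (*-pos 0<c (x<y⇒0<y-x x<y)))

  x≢0⇒0<x*x : ∀ {x} → x ≢ 0# → 0# < x * x
  x≢0⇒0<x*x {x} x≢0 with compare x 0#
  ... | tri< x<0 _   _   = subst (0# <_) (solve 1 (λ x → (:- x) :* (:- x) := x :* x) refl x)
                             (*-pos (x<0⇒0<-x x<0) (x<0⇒0<-x x<0))
  ... | tri≈ _   x≡0 _   = ⊥-elim (x≢0 x≡0)
  ... | tri> _   _   0<x = *-pos 0<x 0<x

  0≤x*x : ∀ x → 0# ≤ x * x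
  0≤x*x x with compare x 0#
  ... | tri≈ _ refl _ = inj₂ (sym (zeroˡ 0#))
  ... | tri< x<0 _ _  = inj₁ (x≢0⇒0<x*x (λ x≡0 → <-irrefl (subst (_< 0#) x≡0 x<0)))
  ... | tri> _ _ 0<x  = inj₁ (*-pos 0<x 0<x)

  0<1 : 0# < 1#
  0<1 with compare 0# 1#
  ... | tri< 0<1 _   _   = 0<1
  ... | tri≈ _   0≡1 _   = ⊥-elim (0≢1 0≡1)
  ... | tri> _   _   1<0 = ⊥-elim (<-asym 1<0
          (subst (0# <_) (solve 0 ((:- con1) :* (:- con1) := con1) refl)
            (*-pos (x<0⇒0<-x 1<0) (x<0⇒0<-x 1<0))))

  0<x*x+y*y : ∀ {x y} → ¬ (x ≡ 0# × y ≡ 0#) → 0# < x * x + y * y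
  0<x*x+y*y {x} {y} xy≢0 with compare x 0# | compare y 0#
  ... | tri≈ _ x≡0 _ | tri≈ _ y≡0 _ = ⊥-elim (xy≢0 (x≡0 , y≡0))
  ... | tri≈ _ _ _   | tri< _ y≢0 _ = subst (0# <_) (+-comm (y * y) (x * x)) (+-pos-nonNeg (x≢0⇒0<x*x y≢0) (0≤x*x x))
  ... | tri≈ _ _ _   | tri> _ y≢0 _ = subst (0# <_) (+-comm (y * y) (x * x)) (+-pos-nonNeg (x≢0⇒0<x*x y≢0) (0≤x*x x))
  ... | tri< _ x≢0 _ | _            = +-pos-nonNeg (x≢0⇒0<x*x x≢0) (0≤x*x y)
  ... | tri> _ x≢0 _ | _            = +-pos-nonNeg (x≢0⇒0<x*x x≢0) (0≤x*x y)

  pos-inverse : ∀ {x} → 0# < x → ∃[ y ] (x * y ≡ 1# × 0# < y)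
  pos-inverse {x} 0<x with inverse x (λ x≡0 → <-irrefl (subst (0# <_) x≡0 0<x))
  ... | y , xy≡1 with compare 0# y
  ...   | tri< 0<y _    _   = y , xy≡1 , 0<y
  ...   | tri≈ _   refl _   = ⊥-elim (0≢1 (trans (sym (zeroʳ x)) xy≡1))
  ...   | tri> _   _    y<0 = ⊥-elim (<-asym 0<1
          (subst₂ _<_ xy≡1 (zeroʳ x) (*-monoˡ-<-pos 0<x y<0)))

  0<x+y⇒0<x⊎0<y : ∀ {x y} → 0# < x + y → 0# < x ⊎ 0# < y
  0<x+y⇒0<x⊎0<y {x} {y} 0<x+y with 0<⊎≤0 x | 0<⊎≤0 y
  ... | inj₁ 0<x | _        = inj₁ 0<x
  ... | inj₂ _   | inj₁ 0<y = inj₂ 0<y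
  ... | inj₂ x≤0 | inj₂ y≤0 = ⊥-elim (≤⇒≯ (subst (x + y ≤_) (+-identityʳ 0#) (+-mono-≤ x≤0 y≤0)) 0<x+y)

  0<x*y⇒same-sign : ∀ {x y} → 0# < x * y → (0# < x × 0# < y) ⊎ (x < 0# × y < 0#)
  0<x*y⇒same-sign {x} {y} 0<xy with compare x 0# | compare y 0#
  ... | tri< x<0 _ _  | tri< y<0 _ _  = inj₂ (x<0 , y<0)
  ... | tri> _ _ 0<x  | tri> _ _ 0<y  = inj₁ (0<x , 0<y)
  ... | tri≈ _ refl _ | _             = ⊥-elim (<-irrefl (subst (0# <_) (zeroˡ y) 0<xy))
  ... | _             | tri≈ _ refl _ = ⊥-elim (<-irrefl (subst (0# <_) (zeroʳ x) 0<xy))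
  ... | tri< x<0 _ _  | tri> _ _ 0<y  = ⊥-elim (<-asym 0<xy
    (subst (_< 0#) (solve 2 (λ x y → :- ((:- x) :* y) := x :* y) refl x y) (0<x⇒-x<0 (*-pos (x<0⇒0<-x x<0) 0<y))))
  ... | tri> _ _ 0<x  | tri< y<0 _ _  = ⊥-elim (<-asym 0<xy
    (subst (_< 0#) (solve 2 (λ x y → :- (x :* (:- y)) := x :* y) refl x y) (0<x⇒-x<0 (*-pos 0<x (x<0⇒0<-x y<0)))))

  ≤-nonNeg-bound : ∀ x → ∃[ y ] (x ≤ y × 0# ≤ y)
  ≤-nonNeg-bound x with <0⊎0≤ x
  ... | inj₁ x<0 = 0# , inj₁ x<0 , ≤-refl
  ... | inj₂ 0≤x = x , ≤-refl , 0≤x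

  x≤[x*e+z]*e⁻¹ : ∀ {x z e e⁻¹} → 0# ≤ z → 0# ≤ e⁻¹ → e * e⁻¹ ≡ 1# → x ≤ (x * e + z) * e⁻¹
  x≤[x*e+z]*e⁻¹ {x} {z} {e} {e⁻¹} 0≤z 0≤e⁻¹ ee⁻¹≡1 = begin
    x                    ≡⟨ sym (+-identityʳ x) ⟩
    x + 0#               ≤⟨ +-monoʳ-≤ x (*-nonNeg 0≤z 0≤e⁻¹) ⟩
    x + z * e⁻¹          ≡⟨ cong (λ w → w + z * e⁻¹) (sym (trans (cong (x *_) ee⁻¹≡1) (*-identityʳ x))) ⟩
    x * (e * e⁻¹) + z * e⁻¹ ≡⟨ solve 4 (λ x z e e⁻¹ → x :* (e :* e⁻¹) :+ z :* e⁻¹ := (x :* e :+ z) :* e⁻¹)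
                                 refl x z e e⁻¹ ⟩
    (x * e + z) * e⁻¹    ∎
    where open ≤-Reasoning

  fromℕ-nonNeg : ∀ n → 0# ≤ fromℕ ℝ n
  fromℕ-pos : ∀ n → 0# < fromℕ ℝ (suc n)
  fromℕ-nonNeg zero    = ≤-refl
  fromℕ-nonNeg (suc n) = inj₁ (fromℕ-pos n)
  fromℕ-pos n = +-pos-nonNeg 0<1 (fromℕ-nonNeg n)

  fromℤ-mono-≤ : ∀ {i j} → i ℤ.≤ j → fromℤ ℝ i ≤ fromℤ ℝ j
  fromℤ-mono-≤ {i} {j} i≤j = 0≤y-x⇒x≤y (subst (0# ≤_) fromℤ[j-i] (fromℕ-nonNeg ℤ.∣ j ℤ.- i ∣))
    where
    fromℤ[j-i] : fromℕ ℝ ℤ.∣ j ℤ.- i ∣ ≡ fromℤ ℝ j - fromℤ ℝ i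
    fromℤ[j-i] = begin
      fromℤ ℝ (ℤ.+ ℤ.∣ j ℤ.- i ∣)    ≡⟨ cong (fromℤ ℝ) (ℤ.0≤i⇒+∣i∣≡i (ℤ.i≤j⇒0≤j-i i≤j)) ⟩
      fromℤ ℝ (j ℤ.- i)              ≡⟨ fromℤ-+ j (ℤ.- i) ⟩
      fromℤ ℝ j + fromℤ ℝ (ℤ.- i)    ≡⟨ cong (fromℤ ℝ j +_) (fromℤ-neg i) ⟩
      fromℤ ℝ j - fromℤ ℝ i          ∎
      where open ≡-Reasoning

  fromℤ-mono-< : ∀ {i j} → i ℤ.< j → fromℤ ℝ i < fromℤ ℝ j
  fromℤ-mono-< {i} {j} i<j = begin-strict
    fromℤ ℝ i                       ≡⟨ sym (+-identityˡ _) ⟩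
    0# + fromℤ ℝ i                  <⟨ +-mono-< (fromℤ ℝ i) (fromℕ-pos 0) ⟩
    fromℤ ℝ (ℤ.+ 1) + fromℤ ℝ i     ≡⟨ sym (fromℤ-+ (ℤ.+ 1) i) ⟩
    fromℤ ℝ (ℤ.suc i)               ≤⟨ fromℤ-mono-≤ (ℤ.i<j⇒suc[i]≤j i<j) ⟩
    fromℤ ℝ j                       ∎
    where open ≤-Reasoning

module Archimedean (ℝ : RealField) (lem : ExcludedMiddle 0ℓ) where
  open RealField ℝ
  open RealFieldProperties ℝ

  dne : ∀ {P : Set} → ¬ ¬ P → P
  dne = em⇒dne lem

  archimedean : ∀ B → ∃[ n ] (B < fromℕ ℝ n)
  archimedean B = dne λ unbounded → no-supremum (lub IsNatural (0# , 0 , refl) (B , bounded unbounded))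
    where
    IsNatural : Carrier → Set
    IsNatural x = ∃[ n ] (x ≡ fromℕ ℝ n)

    bounded : ¬ (∃[ n ] (B < fromℕ ℝ n)) → ∀ x → IsNatural x → x ≤ B
    bounded unbounded _ (n , refl) = ≮⇒≥ (λ B<n → unbounded (n , B<n))

    no-supremum : ¬ (∃[ s ] ((∀ x → IsNatural x → x ≤ s) × (∀ b → (∀ x → IsNatural x → x ≤ b) → s ≤ b)))
    no-supremum (s , upper , least) with lem {∃[ n ] (s - 1# < fromℕ ℝ n)}
    ... | yes (n , s-1<n) = ≤⇒≯ (upper _ (suc n , refl)) (begin-strict
      s                ≡⟨ solve 1 (λ s → s := con1 :+ (s :- con1)) refl s ⟩
      1# + (s - 1#)    <⟨ +-monoʳ-< 1# s-1<n ⟩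
      fromℕ ℝ (suc n)  ∎)
      where open ≤-Reasoning
    ... | no ¬s-1<n = ≤⇒≯ (least (s - 1#) λ { _ (n , refl) → ≮⇒≥ (λ s-1<n → ¬s-1<n (n , s-1<n)) })
      (0<y-x⇒x<y (subst (0# <_) (solve 1 (λ s → con1 := s :- (s :- con1)) refl s) 0<1))

module Segments (ℝ : RealField) where
  open RealField ℝ
  open RealFieldProperties ℝ

  affine-nonNeg : ∀ {f₀ f₁ s} → 0# ≤ f₀ → 0# ≤ f₁ → 0# ≤ s → s ≤ 1# → 0# ≤ f₀ + s * (f₁ - f₀)
  affine-nonNeg {f₀} {f₁} {s} 0≤f₀ 0≤f₁ 0≤s s≤1 =
    subst (0# ≤_) (solve 3 (λ f₀ f₁ s → (con1 :- s) :* f₀ :+ s :* f₁ := f₀ :+ s :* (f₁ :- f₀)) refl f₀ f₁ s)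
      (+-nonNeg (*-nonNeg (x≤y⇒0≤y-x s≤1) 0≤f₀) (*-nonNeg 0≤s 0≤f₁))

  -- the root is s = f₀ / (f₀ - f₁)
  affine-root : ∀ {f₀ f₁} → 0# ≤ f₀ → f₁ < 0# →
    ∃[ s ] (0# ≤ s × s ≤ 1# × f₀ + s * (f₁ - f₀) ≡ 0# ×
            (∀ s′ → 0# ≤ s′ → s′ ≤ s → 0# ≤ f₀ + s′ * (f₁ - f₀)))
  affine-root {f₀} {f₁} 0≤f₀ f₁<0 = s , 0≤s , s≤1 , root , nonNeg-before
    where
    D = f₀ - f₁
    0<D : 0# < D
    0<D = x<y⇒0<y-x (<-≤-trans f₁<0 0≤f₀)
    I = proj₁ (pos-inverse 0<D)
    DI≡1 : D * I ≡ 1#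
    DI≡1 = proj₁ (proj₂ (pos-inverse 0<D))
    0<I : 0# < I
    0<I = proj₂ (proj₂ (pos-inverse 0<D))
    s = f₀ * I
    0≤s : 0# ≤ s
    0≤s = *-nonNeg 0≤f₀ (inj₁ 0<I)
    s≤1 : s ≤ 1#
    s≤1 = subst (s ≤_) DI≡1 (*-monoʳ-≤-nonNeg (inj₁ 0<I)
            (subst (_≤ D) (+-identityʳ f₀) (+-monoʳ-≤ f₀ (inj₁ (x<0⇒0<-x f₁<0)))))
    sD≡f₀ : s * D ≡ f₀
    sD≡f₀ = trans (solve 3 (λ f₀ I D → f₀ :* I :* D := f₀ :* (D :* I)) refl f₀ I D)
                  (trans (cong (f₀ *_) DI≡1) (*-identityʳ f₀))
    along : ∀ s′ → f₀ + s′ * (f₁ - f₀) ≡ f₀ - (s′ * D)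
    along s′ = solve 3 (λ f₀ f₁ s′ → f₀ :+ s′ :* (f₁ :- f₀) := f₀ :- s′ :* (f₀ :- f₁)) refl f₀ f₁ s′
    root : f₀ + s * (f₁ - f₀) ≡ 0#
    root = trans (along s) (trans (cong (λ z → f₀ - z) sD≡f₀) (-‿inverseʳ f₀))
    nonNeg-before : ∀ s′ → 0# ≤ s′ → s′ ≤ s → 0# ≤ f₀ + s′ * (f₁ - f₀)
    nonNeg-before s′ _ s′≤s = subst (0# ≤_) (sym (along s′))
      (x≤y⇒0≤y-x (subst (s′ * D ≤_) sD≡f₀ (*-monoʳ-≤-nonNeg (inj₁ 0<D) s′≤s)))

module WedgeGeometry (ℝ : RealField) (ox oy p₁ q₁ p₂ q₂ : RealField.Carrier ℝ) where
  open RealField ℝ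
  open RealFieldProperties ℝ
  open Segments ℝ

  Region : Point ℝ → Set
  Region = InRegion ℝ (ox , oy) (p₁ , q₁) (p₂ , q₂)

  lerp : Point ℝ → Carrier → Point ℝ → Point ℝ
  lerp (ux , uy) s (vx , vy) = ux + s * (vx - ux) , uy + s * (vy - uy)

  Meets : Point ℝ → Point ℝ → Point ℝ → Set
  Meets (dx , dy) (ux , uy) (vx , vy) = ∃[ t ] ∃[ s ] (0# ≤ t × 0# ≤ s × s ≤ 1# ×
    ox + t * dx ≡ ux + s * (vx - ux) × oy + t * dy ≡ uy + s * (vy - uy))

  region-convex : ∀ {P Q} s → 0# ≤ s → s ≤ 1# → Region P → Region Q → Region (lerp P s Q)
  region-convex s 0≤s s≤1 (a₁ , b₁ , 0≤a₁ , 0≤b₁ , refl , refl) (a₂ , b₂ , 0≤a₂ , 0≤b₂ , refl , refl) =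
    mix a₁ a₂ , mix b₁ b₂ , mix-nonNeg 0≤a₁ 0≤a₂ , mix-nonNeg 0≤b₁ 0≤b₂ ,
    lerp-mix ox p₁ p₂ , lerp-mix oy q₁ q₂
    where
    mix : Carrier → Carrier → Carrier
    mix x y = (1# - s) * x + s * y
    mix-nonNeg : ∀ {x y} → 0# ≤ x → 0# ≤ y → 0# ≤ mix x y
    mix-nonNeg 0≤x 0≤y = +-nonNeg (*-nonNeg (x≤y⇒0≤y-x s≤1) 0≤x) (*-nonNeg 0≤s 0≤y)
    lerp-mix : ∀ o d d′ → (o + (a₁ * d + b₁ * d′)) + s * ((o + (a₂ * d + b₂ * d′)) - (o + (a₁ * d + b₁ * d′)))
                          ≡ o + (mix a₁ a₂ * d + mix b₁ b₂ * d′)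
    lerp-mix = solve 8 (λ a₁ b₁ a₂ b₂ s o d d′ →
      (o :+ (a₁ :* d :+ b₁ :* d′)) :+ s :* ((o :+ (a₂ :* d :+ b₂ :* d′)) :- (o :+ (a₁ :* d :+ b₁ :* d′)))
      := o :+ (((con1 :- s) :* a₁ :+ s :* a₂) :* d :+ ((con1 :- s) :* b₁ :+ s :* b₂) :* d′))
      refl a₁ b₁ a₂ b₂ s

  -- RealField's _-_ has no fixity declaration, so it binds tighter than _*_:
  -- products are bracketed before being subtracted
  det : Carrier
  det = (p₁ * q₂) - (q₁ * p₂)

  module Barycentric (k : Carrier) (det*k≡1 : det * k ≡ 1#) where
    α β : Point ℝ → Carrier
    α (x , y) = (((x - ox) * q₂) - ((y - oy) * p₂)) * k
    β (x , y) = ((p₁ * (y - oy)) - (q₁ * (x - ox))) * k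

    cancel : ∀ c → c * (det * k) ≡ c
    cancel c = trans (cong (c *_) det*k≡1) (*-identityʳ c)

    α-region : ∀ a b → α (ox + (a * p₁ + b * p₂) , oy + (a * q₁ + b * q₂)) ≡ a
    α-region a b = trans (solve 9 (λ a b ox oy p₁ q₁ p₂ q₂ k →
      ((((ox :+ (a :* p₁ :+ b :* p₂)) :- ox) :* q₂) :- (((oy :+ (a :* q₁ :+ b :* q₂)) :- oy) :* p₂)) :* k
      := a :* (((p₁ :* q₂) :- (q₁ :* p₂)) :* k)) refl a b ox oy p₁ q₁ p₂ q₂ k) (cancel a)

    β-region : ∀ a b → β (ox + (a * p₁ + b * p₂) , oy + (a * q₁ + b * q₂)) ≡ b
    β-region a b = trans (solve 9 (λ a b ox oy p₁ q₁ p₂ q₂ k →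
      ((p₁ :* ((oy :+ (a :* q₁ :+ b :* q₂)) :- oy)) :- (q₁ :* ((ox :+ (a :* p₁ :+ b :* p₂)) :- ox))) :* k
      := b :* (((p₁ :* q₂) :- (q₁ :* p₂)) :* k)) refl a b ox oy p₁ q₁ p₂ q₂ k) (cancel b)

    reconstructˣ : ∀ x y → ox + (α (x , y) * p₁ + β (x , y) * p₂) ≡ x
    reconstructˣ x y = begin
      ox + (α (x , y) * p₁ + β (x , y) * p₂) ≡⟨ solve 9 (λ ox oy x y p₁ q₁ p₂ q₂ k →
        ox :+ ((((x :- ox) :* q₂) :- ((y :- oy) :* p₂)) :* k :* p₁ :+ ((p₁ :* (y :- oy)) :- (q₁ :* (x :- ox))) :* k :* p₂)
        := ox :+ (x :- ox) :* (((p₁ :* q₂) :- (q₁ :* p₂)) :* k)) refl ox oy x y p₁ q₁ p₂ q₂ k ⟩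
      ox + (x - ox) * (det * k)               ≡⟨ cong (ox +_) (cancel (x - ox)) ⟩
      ox + (x - ox)                           ≡⟨ solve 2 (λ ox x → ox :+ (x :- ox) := x) refl ox x ⟩
      x                                       ∎
      where open ≡-Reasoning

    reconstructʸ : ∀ x y → oy + (α (x , y) * q₁ + β (x , y) * q₂) ≡ y
    reconstructʸ x y = begin
      oy + (α (x , y) * q₁ + β (x , y) * q₂) ≡⟨ solve 9 (λ ox oy x y p₁ q₁ p₂ q₂ k →
        oy :+ ((((x :- ox) :* q₂) :- ((y :- oy) :* p₂)) :* k :* q₁ :+ ((p₁ :* (y :- oy)) :- (q₁ :* (x :- ox))) :* k :* q₂)
        := oy :+ (y :- oy) :* (((p₁ :* q₂) :- (q₁ :* p₂)) :* k)) refl ox oy x y p₁ q₁ p₂ q₂ k ⟩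
      oy + (y - oy) * (det * k)               ≡⟨ cong (oy +_) (cancel (y - oy)) ⟩
      oy + (y - oy)                           ≡⟨ solve 2 (λ oy y → oy :+ (y :- oy) := y) refl oy y ⟩
      y                                       ∎
      where open ≡-Reasoning

    α-lerp : ∀ P Q s → α (lerp P s Q) ≡ α P + s * (α Q - α P)
    α-lerp (ux , uy) (vx , vy) s = solve 10 (λ ox oy ux uy vx vy s p₂ q₂ k →
      ((((ux :+ s :* (vx :- ux)) :- ox) :* q₂) :- (((uy :+ s :* (vy :- uy)) :- oy) :* p₂)) :* k
      := ((((ux :- ox) :* q₂) :- ((uy :- oy) :* p₂)) :* k)
         :+ s :* (((((vx :- ox) :* q₂) :- ((vy :- oy) :* p₂)) :* k) :- ((((ux :- ox) :* q₂) :- ((uy :- oy) :* p₂)) :* k)))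
      refl ox oy ux uy vx vy s p₂ q₂ k

    β-lerp : ∀ P Q s → β (lerp P s Q) ≡ β P + s * (β Q - β P)
    β-lerp (ux , uy) (vx , vy) s = solve 10 (λ ox oy ux uy vx vy s p₁ q₁ k →
      ((p₁ :* ((uy :+ s :* (vy :- uy)) :- oy)) :- (q₁ :* ((ux :+ s :* (vx :- ux)) :- ox))) :* k
      := (((p₁ :* (uy :- oy)) :- (q₁ :* (ux :- ox))) :* k)
         :+ s :* ((((p₁ :* (vy :- oy)) :- (q₁ :* (vx :- ox))) :* k) :- (((p₁ :* (uy :- oy)) :- (q₁ :* (ux :- ox))) :* k)))
      refl ox oy ux uy vx vy s p₁ q₁ k

    region⇒0≤α,β : ∀ {x y} → Region (x , y) → 0# ≤ α (x , y) × 0# ≤ β (x , y)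
    region⇒0≤α,β (a , b , 0≤a , 0≤b , refl , refl) =
      subst (0# ≤_) (sym (α-region a b)) 0≤a , subst (0# ≤_) (sym (β-region a b)) 0≤b

    0≤α,β⇒region : ∀ {x y} → 0# ≤ α (x , y) → 0# ≤ β (x , y) → Region (x , y)
    0≤α,β⇒region {x} {y} 0≤α 0≤β =
      α (x , y) , β (x , y) , 0≤α , 0≤β , sym (reconstructˣ x y) , sym (reconstructʸ x y)

    α-root⇒meets-H₂ : ∀ {P Q s} → 0# ≤ s → s ≤ 1# →
      α P + s * (α Q - α P) ≡ 0# → 0# ≤ β P + s * (β Q - β P) → Meets (p₂ , q₂) P Q
    α-root⇒meets-H₂ {ux , uy} {vx , vy} {s} 0≤s s≤1 root 0≤βs = β R , s , 0≤β , 0≤s , s≤1 , onˣ , onʸ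
      where
      R = lerp (ux , uy) s (vx , vy)
      α≡0 : α R ≡ 0#
      α≡0 = trans (α-lerp (ux , uy) (vx , vy) s) root
      0≤β : 0# ≤ β R
      0≤β = subst (0# ≤_) (sym (β-lerp (ux , uy) (vx , vy) s)) 0≤βs
      onˣ : ox + β R * p₂ ≡ proj₁ R
      onˣ = trans (solve 4 (λ ox t p₁ p₂ → ox :+ t :* p₂ := ox :+ (con0 :* p₁ :+ t :* p₂)) refl ox (β R) p₁ p₂)
              (trans (cong (λ a → ox + (a * p₁ + β R * p₂)) (sym α≡0)) (reconstructˣ (proj₁ R) (proj₂ R)))
      onʸ : oy + β R * q₂ ≡ proj₂ R
      onʸ = trans (solve 4 (λ oy t q₁ q₂ → oy :+ t :* q₂ := oy :+ (con0 :* q₁ :+ t :* q₂)) refl oy (β R) q₁ q₂)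
              (trans (cong (λ a → oy + (a * q₁ + β R * q₂)) (sym α≡0)) (reconstructʸ (proj₁ R) (proj₂ R)))

    β-root⇒meets-H₁ : ∀ {P Q s} → 0# ≤ s → s ≤ 1# →
      β P + s * (β Q - β P) ≡ 0# → 0# ≤ α P + s * (α Q - α P) → Meets (p₁ , q₁) P Q
    β-root⇒meets-H₁ {ux , uy} {vx , vy} {s} 0≤s s≤1 root 0≤αs = α R , s , 0≤α , 0≤s , s≤1 , onˣ , onʸ
      where
      R = lerp (ux , uy) s (vx , vy)
      β≡0 : β R ≡ 0#
      β≡0 = trans (β-lerp (ux , uy) (vx , vy) s) root
      0≤α : 0# ≤ α R
      0≤α = subst (0# ≤_) (sym (α-lerp (ux , uy) (vx , vy) s)) 0≤αs
      onˣ : ox + α R * p₁ ≡ proj₁ R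
      onˣ = trans (solve 4 (λ ox t p₁ p₂ → ox :+ t :* p₁ := ox :+ (t :* p₁ :+ con0 :* p₂)) refl ox (α R) p₁ p₂)
              (trans (cong (λ b → ox + (α R * p₁ + b * p₂)) (sym β≡0)) (reconstructˣ (proj₁ R) (proj₂ R)))
      onʸ : oy + α R * q₁ ≡ proj₂ R
      onʸ = trans (solve 4 (λ oy t q₁ q₂ → oy :+ t :* q₁ := oy :+ (t :* q₁ :+ con0 :* q₂)) refl oy (α R) q₁ q₂)
              (trans (cong (λ b → oy + (α R * q₁ + b * q₂)) (sym β≡0)) (reconstructʸ (proj₁ R) (proj₂ R)))

    exit-meets-boundary : ∀ {P Q} → Region P → ¬ Region Q → Meets (p₁ , q₁) P Q ⊎ Meets (p₂ , q₂) P Q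
    exit-meets-boundary {P} {Q} P∈ Q∉ = cases (region⇒0≤α,β P∈) (<0⊎0≤ (α Q)) (<0⊎0≤ (β Q))
      where
      cases : 0# ≤ α P × 0# ≤ β P → α Q < 0# ⊎ 0# ≤ α Q → β Q < 0# ⊎ 0# ≤ β Q →
              Meets (p₁ , q₁) P Q ⊎ Meets (p₂ , q₂) P Q
      cases _ (inj₂ 0≤αQ) (inj₂ 0≤βQ) = ⊥-elim (Q∉ (0≤α,β⇒region 0≤αQ 0≤βQ))
      cases (0≤αP , 0≤βP) (inj₁ αQ<0) (inj₂ 0≤βQ) =
        let sα , 0≤sα , sα≤1 , αroot , _ = affine-root 0≤αP αQ<0
        in inj₂ (α-root⇒meets-H₂ 0≤sα sα≤1 αroot (affine-nonNeg 0≤βP 0≤βQ 0≤sα sα≤1))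
      cases (0≤αP , 0≤βP) (inj₂ 0≤αQ) (inj₁ βQ<0) =
        let sβ , 0≤sβ , sβ≤1 , βroot , _ = affine-root 0≤βP βQ<0
        in inj₁ (β-root⇒meets-H₁ 0≤sβ sβ≤1 βroot (affine-nonNeg 0≤αP 0≤αQ 0≤sβ sβ≤1))
      cases (0≤αP , 0≤βP) (inj₁ αQ<0) (inj₁ βQ<0) =
        let sα , 0≤sα , sα≤1 , αroot , α-before = affine-root 0≤αP αQ<0
            sβ , 0≤sβ , sβ≤1 , βroot , β-before = affine-root 0≤βP βQ<0
        in Sum.map (λ sβ≤sα → β-root⇒meets-H₁ 0≤sβ sβ≤1 βroot (α-before sβ 0≤sβ sβ≤sα))
                   (λ sα≤sβ → α-root⇒meets-H₂ 0≤sα sα≤1 αroot (β-before sα 0≤sα sα≤sβ)) (≤-total sβ sα)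

  parallel⇒d₂≡k*d₁ : det ≡ 0# → NonZeroVec ℝ (p₁ , q₁) → 0# < dot ℝ (p₁ , q₁) (p₂ , q₂) →
                      ∃[ k ] (0# < k × k * p₁ ≡ p₂ × k * q₁ ≡ q₂)
  parallel⇒d₂≡k*d₁ det≡0 d₁≢0 0<δ = δ * m , *-pos 0<δ 0<m , k*w≡w₂ n*p₂≡δ*p₁ , k*w≡w₂ n*q₂≡δ*q₁
    where
    open ≡-Reasoning
    n = p₁ * p₁ + q₁ * q₁
    δ = dot ℝ (p₁ , q₁) (p₂ , q₂)
    n⁻¹ = pos-inverse (0<x*x+y*y d₁≢0)
    m = proj₁ n⁻¹
    0<m : 0# < m
    0<m = proj₂ (proj₂ n⁻¹)
    n*p₂≡δ*p₁ : n * p₂ ≡ δ * p₁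
    n*p₂≡δ*p₁ = begin
      n * p₂                  ≡⟨ solve 4 (λ p₁ q₁ p₂ q₂ → (p₁ :* p₁ :+ q₁ :* q₁) :* p₂
                                   := (p₁ :* p₂ :+ q₁ :* q₂) :* p₁ :- q₁ :* ((p₁ :* q₂) :- (q₁ :* p₂)))
                                   refl p₁ q₁ p₂ q₂ ⟩
      (δ * p₁) - (q₁ * det)   ≡⟨ cong (λ z → (δ * p₁) - (q₁ * z)) det≡0 ⟩
      (δ * p₁) - (q₁ * 0#)    ≡⟨ solve 2 (λ x q → x :- q :* con0 := x) refl (δ * p₁) q₁ ⟩
      δ * p₁                  ∎
    n*q₂≡δ*q₁ : n * q₂ ≡ δ * q₁
    n*q₂≡δ*q₁ = begin
      n * q₂                  ≡⟨ solve 4 (λ p₁ q₁ p₂ q₂ → (p₁ :* p₁ :+ q₁ :* q₁) :* q₂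
                                   := (p₁ :* p₂ :+ q₁ :* q₂) :* q₁ :+ p₁ :* ((p₁ :* q₂) :- (q₁ :* p₂)))
                                   refl p₁ q₁ p₂ q₂ ⟩
      δ * q₁ + p₁ * det       ≡⟨ cong (λ z → δ * q₁ + p₁ * z) det≡0 ⟩
      δ * q₁ + p₁ * 0#        ≡⟨ solve 2 (λ x p → x :+ p :* con0 := x) refl (δ * q₁) p₁ ⟩
      δ * q₁                  ∎
    k*w≡w₂ : ∀ {w w₂} → n * w₂ ≡ δ * w → δ * m * w ≡ w₂
    k*w≡w₂ {w} {w₂} n*w₂≡δ*w = begin
      δ * m * w     ≡⟨ solve 3 (λ δ m w → δ :* m :* w := m :* (δ :* w)) refl δ m w ⟩
      m * (δ * w)   ≡⟨ cong (m *_) (sym n*w₂≡δ*w) ⟩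
      m * (n * w₂)  ≡⟨ solve 3 (λ m n w → m :* (n :* w) := (n :* m) :* w) refl m n w₂ ⟩
      (n * m) * w₂  ≡⟨ cong (_* w₂) (proj₁ (proj₂ n⁻¹)) ⟩
      1# * w₂       ≡⟨ *-identityˡ w₂ ⟩
      w₂            ∎

  -- a degenerate wedge is the half-line H₁ itself, so each of its points is on H₁
  parallel⇒meets-H₁ : det ≡ 0# → NonZeroVec ℝ (p₁ , q₁) → 0# < dot ℝ (p₁ , q₁) (p₂ , q₂) →
                      ∀ {P Q} → Region P → Meets (p₁ , q₁) P Q
  parallel⇒meets-H₁ det≡0 d₁≢0 0<δ {Q = vx , vy} (a , b , 0≤a , 0≤b , refl , refl) =
    let k , 0<k , k*p₁≡p₂ , k*q₁≡q₂ = parallel⇒d₂≡k*d₁ det≡0 d₁≢0 0<δ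
    in a + b * k , 0# , +-nonNeg 0≤a (*-nonNeg 0≤b (inj₁ 0<k)) , ≤-refl , inj₁ 0<1 ,
       at-start ox vx k*p₁≡p₂ , at-start oy vy k*q₁≡q₂
    where
    at-start : ∀ {k w w₂} o v → k * w ≡ w₂ →
               o + (a + b * k) * w ≡ (o + (a * w + b * w₂)) + 0# * (v - (o + (a * w + b * w₂)))
    at-start {k} {w} o v refl = solve 6 (λ o a b k w v → o :+ (a :+ b :* k) :* w
      := (o :+ (a :* w :+ b :* (k :* w))) :+ con0 :* (v :- (o :+ (a :* w :+ b :* (k :* w)))))
      refl o a b k w v

  exit-meets-boundary : NonZeroVec ℝ (p₁ , q₁) → 0# < dot ℝ (p₁ , q₁) (p₂ , q₂) →
                        ∀ {P Q} → Region P → ¬ Region Q → Meets (p₁ , q₁) P Q ⊎ Meets (p₂ , q₂) P Q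
  exit-meets-boundary d₁≢0 0<δ P∈ Q∉ with compare det 0#
  ... | tri≈ _ det≡0 _ = inj₁ (parallel⇒meets-H₁ det≡0 d₁≢0 0<δ P∈)
  ... | tri< _ det≢0 _ = Barycentric.exit-meets-boundary _ (proj₂ (inverse det det≢0)) P∈ Q∉
  ... | tri> _ det≢0 _ = Barycentric.exit-meets-boundary _ (proj₂ (inverse det det≢0)) P∈ Q∉

  dot-region : ∀ e₁ e₂ a b →
    dot ℝ (e₁ , e₂) (ox + (a * p₁ + b * p₂) , oy + (a * q₁ + b * q₂)) - dot ℝ (e₁ , e₂) (ox , oy)
    ≡ a * dot ℝ (e₁ , e₂) (p₁ , q₁) + b * dot ℝ (e₁ , e₂) (p₂ , q₂)
  dot-region e₁ e₂ a b = solve 10 (λ e₁ e₂ a b ox oy p₁ q₁ p₂ q₂ →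
    (e₁ :* (ox :+ (a :* p₁ :+ b :* p₂)) :+ e₂ :* (oy :+ (a :* q₁ :+ b :* q₂))) :- (e₁ :* ox :+ e₂ :* oy)
    := a :* (e₁ :* p₁ :+ e₂ :* q₁) :+ b :* (e₁ :* p₂ :+ e₂ :* q₂)) refl e₁ e₂ a b ox oy p₁ q₁ p₂ q₂

  module _ {e₁ e₂ : Carrier}
    (0<e·d₁ : 0# < dot ℝ (e₁ , e₂) (p₁ , q₁)) (0<e·d₂ : 0# < dot ℝ (e₁ , e₂) (p₂ , q₂)) where

    dot-bounded-below : ∀ {P} → Region P → dot ℝ (e₁ , e₂) (ox , oy) ≤ dot ℝ (e₁ , e₂) P
    dot-bounded-below (a , b , 0≤a , 0≤b , refl , refl) = 0≤y-x⇒x≤y (subst (0# ≤_) (sym (dot-region e₁ e₂ a b))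
      (+-nonNeg (*-nonNeg 0≤a (inj₁ 0<e·d₁)) (*-nonNeg 0≤b (inj₁ 0<e·d₂))))

    dot-dominated : ∀ f₁ f₂ → ∃[ K ] (∀ {P} → Region P →
      dot ℝ (f₁ , f₂) P - dot ℝ (f₁ , f₂) (ox , oy) ≤ (dot ℝ (e₁ , e₂) P - dot ℝ (e₁ , e₂) (ox , oy)) * K)
    dot-dominated f₁ f₂ = I₁ * F₁⁺ + I₂ * F₂⁺ , bound
      where
      E₁ = dot ℝ (e₁ , e₂) (p₁ , q₁)
      E₂ = dot ℝ (e₁ , e₂) (p₂ , q₂)
      F₁ = dot ℝ (f₁ , f₂) (p₁ , q₁)
      F₂ = dot ℝ (f₁ , f₂) (p₂ , q₂)
      E₁⁻¹ = pos-inverse 0<e·d₁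
      E₂⁻¹ = pos-inverse 0<e·d₂
      I₁ = proj₁ E₁⁻¹
      I₂ = proj₁ E₂⁻¹
      F₁-bound = ≤-nonNeg-bound F₁
      F₂-bound = ≤-nonNeg-bound F₂
      F₁⁺ = proj₁ F₁-bound
      F₂⁺ = proj₁ F₂-bound
      bound : ∀ {P} → Region P →
        dot ℝ (f₁ , f₂) P - dot ℝ (f₁ , f₂) (ox , oy)
          ≤ (dot ℝ (e₁ , e₂) P - dot ℝ (e₁ , e₂) (ox , oy)) * (I₁ * F₁⁺ + I₂ * F₂⁺)
      bound (a , b , 0≤a , 0≤b , refl , refl) = begin
        _                                  ≡⟨ dot-region f₁ f₂ a b ⟩
        a * F₁ + b * F₂                    ≤⟨ +-mono-≤ (*-mono-≤-nonNeg 0≤a a≤CI₁ (proj₁ (proj₂ F₁-bound)) (proj₂ (proj₂ F₁-bound)))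
                                                        (*-mono-≤-nonNeg 0≤b b≤CI₂ (proj₁ (proj₂ F₂-bound)) (proj₂ (proj₂ F₂-bound))) ⟩
        (C * I₁) * F₁⁺ + (C * I₂) * F₂⁺    ≡⟨ solve 5 (λ C I₁ F₁ I₂ F₂ → (C :* I₁) :* F₁ :+ (C :* I₂) :* F₂
                                                := C :* (I₁ :* F₁ :+ I₂ :* F₂)) refl C I₁ F₁⁺ I₂ F₂⁺ ⟩
        C * (I₁ * F₁⁺ + I₂ * F₂⁺)          ≡⟨ cong (_* (I₁ * F₁⁺ + I₂ * F₂⁺)) (sym (dot-region e₁ e₂ a b)) ⟩
        _                                  ∎
        where
        open ≤-Reasoning
        C = a * E₁ + b * E₂
        a≤CI₁ : a ≤ C * I₁
        a≤CI₁ = x≤[x*e+z]*e⁻¹ (*-nonNeg 0≤b (inj₁ 0<e·d₂)) (inj₁ (proj₂ (proj₂ E₁⁻¹))) (proj₁ (proj₂ E₁⁻¹))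
        b≤CI₂ : b ≤ C * I₂
        b≤CI₂ = subst (λ c → b ≤ c * I₂) (+-comm (b * E₂) (a * E₁))
                  (x≤[x*e+z]*e⁻¹ (*-nonNeg 0≤a (inj₁ 0<e·d₁)) (inj₁ (proj₂ (proj₂ E₂⁻¹))) (proj₁ (proj₂ E₂⁻¹)))

  region-interval : ∀ {cx cy fx fy r₁ r r₂} → r₁ ≤ r → r ≤ r₂ →
    Region (cx + r₁ * fx , cy + r₁ * fy) → Region (cx + r₂ * fx , cy + r₂ * fy) → Region (cx + r * fx , cy + r * fy)
  region-interval {cx} {cy} {fx} {fy} {r₁} {r} {r₂} r₁≤r r≤r₂ P∈ Q∈ with ≤-trans r₁≤r r≤r₂
  ... | inj₂ refl = subst (λ t → Region (cx + t * fx , cy + t * fy)) (≤-antisym r₁≤r r≤r₂) P∈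
  ... | inj₁ r₁<r₂ = subst Region (cong₂ _,_ (at-r cx fx) (at-r cy fy))
                       (region-convex s 0≤s s≤1 P∈ Q∈)
    where
    D⁻¹ = pos-inverse (x<y⇒0<y-x r₁<r₂)
    s = (r - r₁) * proj₁ D⁻¹
    0≤s : 0# ≤ s
    0≤s = *-nonNeg (x≤y⇒0≤y-x r₁≤r) (inj₁ (proj₂ (proj₂ D⁻¹)))
    s≤1 : s ≤ 1#
    s≤1 = subst (s ≤_) (proj₁ (proj₂ D⁻¹))
            (*-monoʳ-≤-nonNeg (inj₁ (proj₂ (proj₂ D⁻¹))) (+-monoˡ-≤ (- r₁) r≤r₂))
    s[r₂-r₁]≡r-r₁ : s * (r₂ - r₁) ≡ r - r₁
    s[r₂-r₁]≡r-r₁ = begin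
      (r - r₁) * proj₁ D⁻¹ * (r₂ - r₁)   ≡⟨ solve 3 (λ a i d → a :* i :* d := a :* (d :* i))
                                               refl (r - r₁) (proj₁ D⁻¹) (r₂ - r₁) ⟩
      (r - r₁) * ((r₂ - r₁) * proj₁ D⁻¹) ≡⟨ cong ((r - r₁) *_) (proj₁ (proj₂ D⁻¹)) ⟩
      (r - r₁) * 1#                      ≡⟨ *-identityʳ _ ⟩
      r - r₁                             ∎
      where open ≡-Reasoning
    at-r : ∀ c f → (c + r₁ * f) + s * ((c + r₂ * f) - (c + r₁ * f)) ≡ c + r * f
    at-r c f = begin
      (c + r₁ * f) + s * ((c + r₂ * f) - (c + r₁ * f)) ≡⟨ solve 5 (λ c f r₁ r₂ s →
                                                            (c :+ r₁ :* f) :+ s :* ((c :+ r₂ :* f) :- (c :+ r₁ :* f))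
                                                            := c :+ (r₁ :+ s :* (r₂ :- r₁)) :* f) refl c f r₁ r₂ s ⟩
      c + (r₁ + s * (r₂ - r₁)) * f                     ≡⟨ cong (λ t → c + (r₁ + t) * f) s[r₂-r₁]≡r-r₁ ⟩
      c + (r₁ + (r - r₁)) * f                          ≡⟨ cong (λ t → c + t * f) (solve 2 (λ r₁ r → r₁ :+ (r :- r₁) := r) refl r₁ r) ⟩
      c + r * f                                        ∎
      where open ≡-Reasoning

≤⇒≡+ : ∀ {i j} → i ℤ.≤ j → ∃[ k ] (j ≡ i ℤ.+ ℤ.+ k)
≤⇒≡+ {i} {j} i≤j = ℤ.∣ j ℤ.- i ∣ , (begin
  j                          ≡⟨ j≡i+[j-i] i j ⟩
  i ℤ.+ (j ℤ.- i)            ≡⟨ cong (λ d → i ℤ.+ d) (sym (ℤ.0≤i⇒+∣i∣≡i (ℤ.i≤j⇒0≤j-i i≤j))) ⟩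
  i ℤ.+ ℤ.+ ℤ.∣ j ℤ.- i ∣    ∎)
  where
  open ≡-Reasoning
  j≡i+[j-i] : ∀ i j → j ≡ i ℤ.+ (j ℤ.- i)
  j≡i+[j-i] = solve-∀

-- the ring solver does not look through ℤ.suc and ℤ.pred, so the `lemma`s below state
-- them unfolded
i+[1+k]≡suc[i]+k : ∀ i k → i ℤ.+ ℤ.+ suc k ≡ ℤ.suc i ℤ.+ ℤ.+ k
i+[1+k]≡suc[i]+k i k = lemma i (ℤ.+ k)
  where
  lemma : ∀ i j → i ℤ.+ (ℤ.1ℤ ℤ.+ j) ≡ (ℤ.1ℤ ℤ.+ i) ℤ.+ j
  lemma = solve-∀

pred[i+[1+k]]≡i+k : ∀ i k → ℤ.pred (i ℤ.+ ℤ.+ suc k) ≡ i ℤ.+ ℤ.+ k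
pred[i+[1+k]]≡i+k i k = lemma i (ℤ.+ k)
  where
  lemma : ∀ i j → ℤ.-1ℤ ℤ.+ (i ℤ.+ (ℤ.1ℤ ℤ.+ j)) ≡ i ℤ.+ j
  lemma = solve-∀

suc-injective : ∀ {i j} → ℤ.suc i ≡ ℤ.suc j → i ≡ j
suc-injective {i} {j} suc≡ = trans (sym (ℤ.pred-suc i)) (trans (cong ℤ.pred suc≡) (ℤ.pred-suc j))

i<suc[i] : ∀ i → i ℤ.< ℤ.suc i
i<suc[i] i = ℤ.suc[i]≤j⇒i<j ℤ.≤-refl

pred[i]<i : ∀ i → ℤ.pred i ℤ.< i
pred[i]<i i = ℤ.i≤pred[j]⇒i<j ℤ.≤-refl

record Frame : Set where
  field
    col row : Node → ℤ
    fwd back up down : Port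
    col-fwd  : ∀ u → col (go fwd u)  ≡ ℤ.suc (col u)
    row-fwd  : ∀ u → row (go fwd u)  ≡ row u
    col-back : ∀ u → col (go back u) ≡ ℤ.pred (col u)
    row-back : ∀ u → row (go back u) ≡ row u
    col-up   : ∀ u → col (go up u)   ≡ col u
    row-up   : ∀ u → row (go up u)   ≡ ℤ.suc (row u)
    col-down : ∀ u → col (go down u) ≡ col u
    row-down : ∀ u → row (go down u) ≡ ℤ.pred (row u)
    coords-injective : ∀ {u v} → col u ≡ col v → row u ≡ row v → u ≡ v
    ports : ∀ p → p ≡ fwd ⊎ p ≡ back ⊎ p ≡ up ⊎ p ≡ down

  back-fwd : ∀ u → go back (go fwd u) ≡ u
  back-fwd u = coords-injective
    (trans (col-back (go fwd u)) (trans (cong ℤ.pred (col-fwd u)) (ℤ.pred-suc (col u))))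
    (trans (row-back (go fwd u)) (row-fwd u))

i+1≡suc[i] : ∀ i → i ℤ.+ ℤ.1ℤ ≡ ℤ.suc i
i+1≡suc[i] i = ℤ.+-comm i ℤ.1ℤ

i-1≡pred[i] : ∀ i → i ℤ.- ℤ.1ℤ ≡ ℤ.pred i
i-1≡pred[i] i = ℤ.+-comm i ℤ.-1ℤ

-[i-1]≡suc[-i] : ∀ i → ℤ.- (i ℤ.- ℤ.1ℤ) ≡ ℤ.suc (ℤ.- i)
-[i-1]≡suc[-i] = lemma
  where
  lemma : ∀ i → ℤ.- (i ℤ.- ℤ.1ℤ) ≡ ℤ.1ℤ ℤ.+ ℤ.- i
  lemma = solve-∀

-[i+1]≡pred[-i] : ∀ i → ℤ.- (i ℤ.+ ℤ.1ℤ) ≡ ℤ.pred (ℤ.- i)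
-[i+1]≡pred[-i] = lemma
  where
  lemma : ∀ i → ℤ.- (i ℤ.+ ℤ.1ℤ) ≡ ℤ.-1ℤ ℤ.+ ℤ.- i
  lemma = solve-∀

frameE frameW frameN frameS : Frame
frameE = record
  { col = proj₁ ; row = proj₂ ; fwd = E ; back = W ; up = N ; down = S
  ; col-fwd  = λ u → i+1≡suc[i] (proj₁ u)  ; row-fwd  = λ _ → refl
  ; col-back = λ u → i-1≡pred[i] (proj₁ u) ; row-back = λ _ → refl
  ; col-up   = λ _ → refl ; row-up   = λ u → i+1≡suc[i] (proj₂ u)
  ; col-down = λ _ → refl ; row-down = λ u → i-1≡pred[i] (proj₂ u)
  ; coords-injective = cong₂ _,_
  ; ports = λ { E → inj₁ refl ; W → inj₂ (inj₁ refl) ; N → inj₂ (inj₂ (inj₁ refl)) ; S → inj₂ (inj₂ (inj₂ refl)) }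
  }
frameW = record
  { col = λ u → ℤ.- proj₁ u ; row = λ u → ℤ.- proj₂ u ; fwd = W ; back = E ; up = S ; down = N
  ; col-fwd  = λ u → -[i-1]≡suc[-i] (proj₁ u)  ; row-fwd  = λ _ → refl
  ; col-back = λ u → -[i+1]≡pred[-i] (proj₁ u) ; row-back = λ _ → refl
  ; col-up   = λ _ → refl ; row-up   = λ u → -[i-1]≡suc[-i] (proj₂ u)
  ; col-down = λ _ → refl ; row-down = λ u → -[i+1]≡pred[-i] (proj₂ u)
  ; coords-injective = λ x≡ y≡ → cong₂ _,_ (ℤ.neg-injective x≡) (ℤ.neg-injective y≡)
  ; ports = λ { W → inj₁ refl ; E → inj₂ (inj₁ refl) ; S → inj₂ (inj₂ (inj₁ refl)) ; N → inj₂ (inj₂ (inj₂ refl)) }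
  }
frameN = record
  { col = proj₂ ; row = λ u → ℤ.- proj₁ u ; fwd = N ; back = S ; up = W ; down = E
  ; col-fwd  = λ u → i+1≡suc[i] (proj₂ u)  ; row-fwd  = λ _ → refl
  ; col-back = λ u → i-1≡pred[i] (proj₂ u) ; row-back = λ _ → refl
  ; col-up   = λ _ → refl ; row-up   = λ u → -[i-1]≡suc[-i] (proj₁ u)
  ; col-down = λ _ → refl ; row-down = λ u → -[i+1]≡pred[-i] (proj₁ u)
  ; coords-injective = λ y≡ x≡ → cong₂ _,_ (ℤ.neg-injective x≡) y≡
  ; ports = λ { N → inj₁ refl ; S → inj₂ (inj₁ refl) ; W → inj₂ (inj₂ (inj₁ refl)) ; E → inj₂ (inj₂ (inj₂ refl)) }
  }
frameS = record
  { col = λ u → ℤ.- proj₂ u ; row = proj₁ ; fwd = S ; back = N ; up = E ; down = W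
  ; col-fwd  = λ u → -[i-1]≡suc[-i] (proj₂ u)  ; row-fwd  = λ _ → refl
  ; col-back = λ u → -[i+1]≡pred[-i] (proj₂ u) ; row-back = λ _ → refl
  ; col-up   = λ _ → refl ; row-up   = λ u → i+1≡suc[i] (proj₁ u)
  ; col-down = λ _ → refl ; row-down = λ u → i-1≡pred[i] (proj₁ u)
  ; coords-injective = λ y≡ x≡ → cong₂ _,_ x≡ (ℤ.neg-injective y≡)
  ; ports = λ { S → inj₁ refl ; N → inj₂ (inj₁ refl) ; E → inj₂ (inj₂ (inj₁ refl)) ; W → inj₂ (inj₂ (inj₂ refl)) }
  }

data Path (In : Node → Set) : Node → Node → Set where
  here : ∀ {u} → In u → Path In u u
  step : ∀ {u w} p → In u → Path In (go p u) w → Path In u w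

module Sweep (fr : Frame) where
  open Frame fr

  record Sweepable (In : Node → Set) : Set where
    field
      column-convex : ∀ {u w x} → In u → In w → col x ≡ col u → col w ≡ col u →
                      row u ℤ.≤ row x → row x ℤ.≤ row w → In x
      up-exits   : ∀ {u} → In u → ∃[ k ] ¬ In (iterate (go up) u k)
      down-exits : ∀ {u} → In u → ∃[ k ] ¬ In (iterate (go down) u k)
      col-bounded-below : ∃[ c ] (∀ {u} → In u → c ℤ.≤ col u)
      connected : ∀ {u v} → In u → In v → Path In u v

  pattern descend  = zero
  pattern seekBack = suc zero
  pattern ascend   = suc (suc zero)
  pattern sweep    = suc (suc (suc zero))
  pattern seekFwd  = suc (suc (suc (suc zero)))

  -- choosing a blocked port leaves the agent in place; this is how the agent changes
  -- phase at the end of a column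
  transition : Fin 5 → (Port → Bool) → Port × Fin 5
  transition descend  free = down , (if free down then descend else seekBack)
  transition seekBack free = if free back then (back , descend) else (up , (if free up then seekBack else ascend))
  transition ascend   free = up , (if free up then ascend else sweep)
  transition sweep    free = down , (if free down then sweep else seekFwd)
  transition seekFwd  free = if free fwd then (fwd , ascend) else (up , seekFwd)

  automaton : Automaton
  automaton = record { size = 5 ; init = descend ; δ = transition }

  module Run (In : Node → Set) (free : Node → Port → Bool)
    (free⇒in : ∀ {u p} → In u → free u p ≡ true → In (go p u))
    (in⇒free : ∀ {u p} → In u → In (go p u) → free u p ≡ true)
    (region : Sweepable In) where
    open Sweepable region

    Config : Set
    Config = Fin 5 × Node

    next : Config → Config
    next (q , x) = let (p , q′) = transition q (free x) in q′ , (if free x p then go p x else x)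

    _↦*_ : Config → Config → Set
    _↦*_ = Star (λ c c′ → next c ≡ c′)

    Visits : Config → Node → Set
    Visits c v = ∃[ n ] (proj₂ (iterate next c n) ≡ v)

    visits-◅◅ : ∀ {c c′ v} → c ↦* c′ → Visits c′ v → Visits c v
    visits-◅◅ ε          visit   = visit
    visits-◅◅ (refl ◅ r) visit with visits-◅◅ r visit
    ... | n , at-v = suc n , at-v

    moves : ∀ q {x p q′} → transition q (free x) ≡ (p , q′) → free x p ≡ true → next (q , x) ≡ (q′ , go p x)
    moves _ δ≡ free≡ rewrite δ≡ | free≡ = refl

    stays : ∀ q {x p q′} → transition q (free x) ≡ (p , q′) → free x p ≡ false → next (q , x) ≡ (q′ , x)
    stays _ δ≡ free≡ rewrite δ≡ | free≡ = refl

    blocked⇒out : ∀ {u p} → In u → free u p ≡ false → ¬ In (go p u)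
    blocked⇒out u∈ blocked pu∈ with trans (sym blocked) (in⇒free u∈ pu∈)
    ... | ()

    top-is-highest : ∀ {t y} → In t → In y → col y ≡ col t → ¬ In (go up t) → row y ℤ.≤ row t
    top-is-highest {t} {y} t∈ y∈ same t-top = ℤ.≮⇒≥ λ t<y → t-top (column-convex t∈ y∈ (col-up t) same
      (subst (row t ℤ.≤_) (sym (row-up t)) (ℤ.i≤suc[i] (row t)))
      (subst (ℤ._≤ row y) (sym (row-up t)) (ℤ.i<j⇒suc[i]≤j t<y)))

    bottom-is-lowest : ∀ {b y} → In b → In y → col y ≡ col b → ¬ In (go down b) → row b ℤ.≤ row y
    bottom-is-lowest {b} {y} b∈ y∈ same b-bottom = ℤ.≮⇒≥ λ y<b → b-bottom (column-convex y∈ b∈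
      (trans (col-down b) (sym same)) (sym same)
      (subst (row y ℤ.≤_) (sym (row-down b)) (ℤ.i<j⇒i≤pred[j] y<b))
      (subst (ℤ._≤ row b) (sym (row-down b)) (ℤ.<⇒≤ (pred[i]<i (row b)))))

    walk : ∀ {q q′} p → (∀ x → next (q , x) ≡ ((if free x p then q else q′) , (if free x p then go p x else x))) →
           (∀ x → col (go p x) ≡ col x) → ∀ k {x} → In x → ¬ In (iterate (go p) x k) →
           ∃[ y ] (In y × col y ≡ col x × ¬ In (go p y) × (q , x) ↦* (q′ , y))
    walk p stepᵖ colᵖ zero    x∈ exits = ⊥-elim (exits x∈)
    walk p stepᵖ colᵖ (suc k) {x} x∈ exits with free x p in freeᵖ | stepᵖ x
    ... | false | s = x , x∈ , refl , blocked⇒out x∈ freeᵖ , s ◅ ε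
    ... | true  | s with walk p stepᵖ colᵖ k (free⇒in x∈ freeᵖ) exits
    ...   | y , y∈ , same , y-end , r = y , y∈ , trans same (colᵖ x) , y-end , s ◅ r

    up-within : ∀ {x y} k → In x → In y → col y ≡ col x → row y ≡ row x ℤ.+ ℤ.+ suc k →
                In (go up x) × row y ≡ row (go up x) ℤ.+ ℤ.+ k
    up-within {x} {y} k x∈ y∈ same height = above∈ , above-height
      where
      above-height : row y ≡ row (go up x) ℤ.+ ℤ.+ k
      above-height = trans height (trans (i+[1+k]≡suc[i]+k (row x) k) (cong (λ r → r ℤ.+ ℤ.+ k) (sym (row-up x))))
      above∈ : In (go up x)
      above∈ = column-convex x∈ y∈ (col-up x) same
                 (subst (row x ℤ.≤_) (sym (row-up x)) (ℤ.i≤suc[i] (row x)))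
                 (subst (row (go up x) ℤ.≤_) (sym above-height) (ℤ.i≤i+j _ (ℤ.+ k)))

    down-within : ∀ {v x} k → In v → In x → col v ≡ col x → row x ≡ row v ℤ.+ ℤ.+ suc k →
                  In (go down x) × row (go down x) ≡ row v ℤ.+ ℤ.+ k
    down-within {v} {x} k v∈ x∈ same height = below∈ , below-height
      where
      below-height : row (go down x) ≡ row v ℤ.+ ℤ.+ k
      below-height = trans (row-down x) (trans (cong ℤ.pred height) (pred[i+[1+k]]≡i+k (row v) k))
      below∈ : In (go down x)
      below∈ = column-convex v∈ x∈ (trans (col-down x) (sym same)) (sym same)
                 (subst (row v ℤ.≤_) (sym below-height) (ℤ.i≤i+j _ (ℤ.+ k)))
                 (subst (ℤ._≤ row x) (sym (row-down x)) (ℤ.<⇒≤ (pred[i]<i (row x))))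

    sweep-visits : ∀ {v} → In v → ∀ k {x} → In x → col v ≡ col x → row x ≡ row v ℤ.+ ℤ.+ k →
                   Visits (sweep , x) v
    sweep-visits v∈ zero    x∈ same height = 0 , coords-injective (sym same) (trans height (ℤ.+-identityʳ _))
    sweep-visits v∈ (suc k) {x} x∈ same height =
      let below∈ , below-height = down-within k v∈ x∈ same height
          moves : next (sweep , x) ≡ (sweep , go down x)
          moves = cong (λ b → (if b then sweep else seekFwd) , (if b then go down x else x)) (in⇒free x∈ below∈)
      in visits-◅◅ (moves ◅ ε) (sweep-visits v∈ k below∈ (trans same (sym (col-down x))) below-height)

    seekFwd-finds : ∀ {y} → In y → In (go fwd y) → ∀ k {x} → In x → col y ≡ col x → row y ≡ row x ℤ.+ ℤ.+ k →
                    ∃[ z ] (In (go fwd z) × col z ≡ col x × (seekFwd , x) ↦* (ascend , go fwd z))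
    seekFwd-finds y∈ fy∈ k {x} x∈ same height with free x fwd in freeᶠ
    ... | true = x , free⇒in x∈ freeᶠ , refl ,
      moves seekFwd (cong (λ b → if b then (fwd , ascend) else (up , seekFwd)) freeᶠ) freeᶠ ◅ ε
    seekFwd-finds y∈ fy∈ zero x∈ same height | false = ⊥-elim (blocked⇒out x∈ freeᶠ
      (subst (λ z → In (go fwd z)) (coords-injective same (trans height (ℤ.+-identityʳ _))) fy∈))
    seekFwd-finds y∈ fy∈ (suc k) {x} x∈ same height | false
      with up-within k x∈ y∈ same height
    ... | above∈ , above-height with seekFwd-finds y∈ fy∈ k above∈ (trans same (sym (col-up x))) above-height
    ...   | z , fz∈ , samez , r = z , fz∈ , trans samez (col-up x) ,
      moves seekFwd (cong (λ b → if b then (fwd , ascend) else (up , seekFwd)) freeᶠ) (in⇒free x∈ above∈) ◅ r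

    NoBackAbove : Node → Set
    NoBackAbove x = ∀ {y} → In y → col y ≡ col x → row x ℤ.≤ row y → ¬ In (go back y)

    no-back-above : ∀ {x} → In x → free x back ≡ false →
      (∀ {y} → In y → col y ≡ col x → ℤ.suc (row x) ℤ.≤ row y → ¬ In (go back y)) → NoBackAbove x
    no-back-above {x} x∈ freeᵇ strictly-above {y} y∈ same x≤y with row x ℤ.≟ row y
    ... | yes level = blocked⇒out x∈ freeᵇ ∘ subst (λ z → In (go back z)) (coords-injective same (sym level))
    ... | no  below = strictly-above y∈ same (ℤ.i<j⇒suc[i]≤j (ℤ.≤∧≢⇒< x≤y below))

    seekBack-climbs : ∀ k {x} → In x → ¬ In (iterate (go up) x k) →
        (∃[ z ] (In (go back z) × col z ≡ col x × (seekBack , x) ↦* (descend , go back z)))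
      ⊎ (∃[ x′ ] (In x′ × col x′ ≡ col x × (seekBack , x) ↦* (ascend , x′) × NoBackAbove x))
    seekBack-climbs zero x∈ exits = ⊥-elim (exits x∈)
    seekBack-climbs (suc k) {x} x∈ exits with free x back in freeᵇ
    ... | true = inj₁ (x , free⇒in x∈ freeᵇ , refl , moves seekBack δ≡ freeᵇ ◅ ε)
      where
      δ≡ : transition seekBack (free x) ≡ (back , descend)
      δ≡ rewrite freeᵇ = refl
    ... | false with free x up in freeᵘ
    ...   | false = inj₂ (x , x∈ , refl , stays seekBack δ≡ freeᵘ ◅ ε , top-has-no-back)
      where
      δ≡ : transition seekBack (free x) ≡ (up , ascend)
      δ≡ rewrite freeᵇ | freeᵘ = refl
      top-has-no-back : NoBackAbove x
      top-has-no-back = no-back-above x∈ freeᵇ λ y∈ same x<y _ → blocked⇒out x∈ freeᵘ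
        (column-convex x∈ y∈ (col-up x) same (subst (row x ℤ.≤_) (sym (row-up x)) (ℤ.i≤suc[i] (row x)))
                                             (subst (ℤ._≤ _) (sym (row-up x)) x<y))
    ...   | true with seekBack-climbs k (free⇒in x∈ freeᵘ) exits
    ...     | inj₁ (z , bz∈ , samez , r) = inj₁ (z , bz∈ , trans samez (col-up x) , moves seekBack δ≡ freeᵘ ◅ r)
      where
      δ≡ : transition seekBack (free x) ≡ (up , seekBack)
      δ≡ rewrite freeᵇ | freeᵘ = refl
    ...     | inj₂ (x′ , x′∈ , same′ , r , no-back) =
      inj₂ (x′ , x′∈ , trans same′ (col-up x) , moves seekBack δ≡ freeᵘ ◅ r , no-back-from-x)
      where
      δ≡ : transition seekBack (free x) ≡ (up , seekBack)
      δ≡ rewrite freeᵇ | freeᵘ = refl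
      no-back-from-x : NoBackAbove x
      no-back-from-x = no-back-above x∈ freeᵇ λ y∈ same x<y →
        no-back y∈ (trans same (sym (col-up x))) (subst (ℤ._≤ _) (sym (row-up x)) x<y)

    NoBackIn : ℤ → Set
    NoBackIn c = ∀ {y} → In y → col y ≡ c → ¬ In (go back y)

    retreat-or-settle : ∀ {u} → In u →
        (∃[ z ] (In (go back z) × col z ≡ col u × (descend , u) ↦* (descend , go back z)))
      ⊎ (∃[ x′ ] (In x′ × col x′ ≡ col u × (descend , u) ↦* (ascend , x′) × NoBackIn (col u)))
    retreat-or-settle u∈ with walk down (λ _ → refl) col-down (proj₁ (down-exits u∈)) u∈ (proj₂ (down-exits u∈))
    ... | b , b∈ , sameb , b-bottom , r with seekBack-climbs (proj₁ (up-exits b∈)) b∈ (proj₂ (up-exits b∈))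
    ...   | inj₁ (z , bz∈ , samez , r′) = inj₁ (z , bz∈ , trans samez sameb , r ◅◅ r′)
    ...   | inj₂ (x′ , x′∈ , same′ , r′ , no-back) = inj₂ (x′ , x′∈ , trans same′ sameb , r ◅◅ r′ ,
      λ y∈ samey → let same-b = trans samey (sym sameb) in no-back y∈ same-b (bottom-is-lowest b∈ y∈ same-b b-bottom))

    c₀ : ℤ
    c₀ = proj₁ col-bounded-below

    settle : ∀ m {u} → In u → col u ≡ c₀ ℤ.+ ℤ.+ m →
             ∃[ x′ ] (In x′ × (descend , u) ↦* (ascend , x′) × NoBackIn (col x′))
    settle m u∈ height with retreat-or-settle u∈
    ... | inj₂ (x′ , x′∈ , same , r , no-back) = x′ , x′∈ , r , subst NoBackIn (sym same) no-back
    settle zero u∈ height | inj₁ (z , bz∈ , same , r) = ⊥-elim (ℤ.<⇒≱ (pred[i]<i c₀)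
      (subst (c₀ ℤ.≤_) (trans (col-back z) (cong ℤ.pred (trans same (trans height (ℤ.+-identityʳ c₀)))))
        (proj₂ col-bounded-below bz∈)))
    settle (suc m) u∈ height | inj₁ (z , bz∈ , same , r) with settle m bz∈
        (trans (col-back z) (trans (cong ℤ.pred (trans same height)) (pred[i+[1+k]]≡i+k c₀ m)))
    ... | x′ , x′∈ , r′ , no-back = x′ , x′∈ , r ◅◅ r′ , no-back

    path-start : ∀ {u w} → Path In u w → In u
    path-start (here u∈)     = u∈
    path-start (step _ u∈ _) = u∈

    fwd-crossing : ∀ {u w} → Path In u w → ∀ {c} → col u ℤ.< c → c ℤ.≤ col w →
                   ∃[ y ] (In y × In (go fwd y) × ℤ.suc (col y) ≡ c)
    fwd-crossing (here _) u<c c≤u = ⊥-elim (ℤ.<⇒≱ u<c c≤u)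
    fwd-crossing {u} (step p u∈ path) {c} u<c c≤w with ports p
    ... | inj₁ refl with ℤ.suc (col u) ℤ.≟ c
    ...   | yes crossed = u , u∈ , path-start path , crossed
    ...   | no  short   = fwd-crossing path (subst (ℤ._< c) (sym (col-fwd u))
                            (ℤ.≤∧≢⇒< (ℤ.i<j⇒suc[i]≤j u<c) short)) c≤w
    fwd-crossing {u} (step p u∈ path) u<c c≤w | inj₂ (inj₁ refl) =
      fwd-crossing path (subst (ℤ._< _) (sym (col-back u)) (ℤ.<-trans (pred[i]<i (col u)) u<c)) c≤w
    fwd-crossing {u} (step p u∈ path) u<c c≤w | inj₂ (inj₂ (inj₁ refl)) =
      fwd-crossing path (subst (ℤ._< _) (sym (col-up u)) u<c) c≤w
    fwd-crossing {u} (step p u∈ path) u<c c≤w | inj₂ (inj₂ (inj₂ refl)) =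
      fwd-crossing path (subst (ℤ._< _) (sym (col-down u)) u<c) c≤w

    column-visited : ∀ {x v} → In x → In v → col v ≡ col x → Visits (ascend , x) v
    column-visited x∈ v∈ same with walk up (λ _ → refl) col-up (proj₁ (up-exits x∈)) x∈ (proj₂ (up-exits x∈))
    ... | t , t∈ , samet , t-top , r =
      let samevt = trans same (sym samet)
          k , height = ≤⇒≡+ (top-is-highest t∈ v∈ samevt t-top)
      in visits-◅◅ r (sweep-visits v∈ k t∈ samevt height)

    advance : ∀ {x y} → In x → In y → In (go fwd y) → col y ≡ col x →
              ∃[ z ] (In (go fwd z) × col z ≡ col x × (ascend , x) ↦* (ascend , go fwd z))
    advance x∈ y∈ fy∈ samey with walk up (λ _ → refl) col-up (proj₁ (up-exits x∈)) x∈ (proj₂ (up-exits x∈))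
    ... | t , t∈ , samet , t-top , r
      with walk down (λ _ → refl) col-down (proj₁ (down-exits t∈)) t∈ (proj₂ (down-exits t∈))
    ...   | b , b∈ , sameb , b-bottom , r′ with trans samey (sym (trans sameb samet))
    ...     | same-yb with ≤⇒≡+ (bottom-is-lowest b∈ y∈ same-yb b-bottom)
    ...       | k , height with seekFwd-finds y∈ fy∈ k b∈ same-yb height
    ...         | z , fz∈ , samez , r″ = z , fz∈ , trans samez (trans sameb samet) , r ◅◅ r′ ◅◅ r″

    sweep-from : ∀ {v} → In v → ∀ m {x} → In x → col v ≡ col x ℤ.+ ℤ.+ m → Visits (ascend , x) v
    sweep-from v∈ zero    x∈ dist = column-visited x∈ v∈ (trans dist (ℤ.+-identityʳ _))
    sweep-from {v} v∈ (suc m) {x} x∈ dist =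
      let y , y∈ , fy∈ , col-y = fwd-crossing (connected x∈ v∈) (i<suc[i] (col x))
                                   (subst (ℤ.suc (col x) ℤ.≤_) (sym dist-next) (ℤ.i≤i+j _ (ℤ.+ m)))
          z , fz∈ , samez , r = advance x∈ y∈ fy∈ (suc-injective col-y)
      in visits-◅◅ r (sweep-from v∈ m fz∈ (trans dist-next (cong (λ c → c ℤ.+ ℤ.+ m)
                                            (sym (trans (col-fwd z) (cong ℤ.suc samez))))))
      where
      dist-next : col v ≡ ℤ.suc (col x) ℤ.+ ℤ.+ m
      dist-next = trans dist (i+[1+k]≡suc[i]+k (col x) m)

    leftmost : ∀ {x v} → In x → NoBackIn (col x) → In v → col x ℤ.≤ col v
    leftmost x∈ no-back v∈ = ℤ.≮⇒≥ λ v<x →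
      let y , y∈ , fy∈ , col-y = fwd-crossing (connected v∈ x∈) v<x ℤ.≤-refl
      in no-back fy∈ (trans (col-fwd y) col-y) (subst In (sym (back-fwd y)) y∈)

    explores : ∀ {u v} → In u → In v → Visits (descend , u) v
    explores u∈ v∈ =
      let m , height = ≤⇒≡+ (proj₂ col-bounded-below u∈)
          x , x∈ , r , no-back = settle m u∈ height
          m′ , dist = ≤⇒≡+ (leftmost x∈ no-back v∈)
      in visits-◅◅ r (sweep-from v∈ m′ x∈ dist)

module RealFrames (ℝ : RealField) where
  open RealField ℝ
  open RealFieldProperties ℝ

  record RealFrame (fr : Frame) : Set where
    open Frame fr
    field
      ε₁ ε₂ φ₁ φ₂ : Carrier
      embedˣ : ∀ u → fromℤ ℝ (proj₁ u) ≡ fromℤ ℝ (col u) * ε₁ + fromℤ ℝ (row u) * φ₁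
      embedʸ : ∀ u → fromℤ ℝ (proj₂ u) ≡ fromℤ ℝ (col u) * ε₂ + fromℤ ℝ (row u) * φ₂
      ε·embed : ∀ u → dot ℝ (ε₁ , ε₂) (embed ℝ u) ≡ fromℤ ℝ (col u)
      φ·embed : ∀ u → dot ℝ (φ₁ , φ₂) (embed ℝ u) ≡ fromℤ ℝ (row u)

  realFrame : (fr : Frame) (ε₁ ε₂ φ₁ φ₂ : Carrier) (C R : Carrier → Carrier → Carrier) →
    (∀ u → fromℤ ℝ (Frame.col fr u) ≡ C (fromℤ ℝ (proj₁ u)) (fromℤ ℝ (proj₂ u))) →
    (∀ u → fromℤ ℝ (Frame.row fr u) ≡ R (fromℤ ℝ (proj₁ u)) (fromℤ ℝ (proj₂ u))) →
    (∀ X Y → X ≡ C X Y * ε₁ + R X Y * φ₁) → (∀ X Y → Y ≡ C X Y * ε₂ + R X Y * φ₂) →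
    (∀ X Y → ε₁ * X + ε₂ * Y ≡ C X Y) → (∀ X Y → φ₁ * X + φ₂ * Y ≡ R X Y) → RealFrame fr
  realFrame fr ε₁ ε₂ φ₁ φ₂ C R col≡ row≡ X≡ Y≡ ε·≡ φ·≡ = record
    { ε₁ = ε₁ ; ε₂ = ε₂ ; φ₁ = φ₁ ; φ₂ = φ₂
    ; embedˣ  = λ u → trans (X≡ _ _) (sym (cong₂ (λ c r → c * ε₁ + r * φ₁) (col≡ u) (row≡ u)))
    ; embedʸ  = λ u → trans (Y≡ _ _) (sym (cong₂ (λ c r → c * ε₂ + r * φ₂) (col≡ u) (row≡ u)))
    ; ε·embed = λ u → trans (ε·≡ _ _) (sym (col≡ u))
    ; φ·embed = λ u → trans (φ·≡ _ _) (sym (row≡ u))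
    }

  realFrameE : RealFrame frameE
  realFrameE = realFrame frameE 1# 0# 0# 1# (λ X Y → X) (λ X Y → Y) (λ _ → refl) (λ _ → refl)
    (solve 2 (λ X Y → X := X :* con1 :+ Y :* con0) refl)
    (solve 2 (λ X Y → Y := X :* con0 :+ Y :* con1) refl)
    (solve 2 (λ X Y → con1 :* X :+ con0 :* Y := X) refl)
    (solve 2 (λ X Y → con0 :* X :+ con1 :* Y := Y) refl)
  realFrameW : RealFrame frameW
  realFrameW = realFrame frameW (- 1#) 0# 0# (- 1#) (λ X Y → - X) (λ X Y → - Y)
    (λ u → fromℤ-neg (proj₁ u)) (λ u → fromℤ-neg (proj₂ u))
    (solve 2 (λ X Y → X := (:- X) :* (:- con1) :+ (:- Y) :* con0) refl)
    (solve 2 (λ X Y → Y := (:- X) :* con0 :+ (:- Y) :* (:- con1)) refl)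
    (solve 2 (λ X Y → (:- con1) :* X :+ con0 :* Y := :- X) refl)
    (solve 2 (λ X Y → con0 :* X :+ (:- con1) :* Y := :- Y) refl)
  realFrameN : RealFrame frameN
  realFrameN = realFrame frameN 0# 1# (- 1#) 0# (λ X Y → Y) (λ X Y → - X)
    (λ _ → refl) (λ u → fromℤ-neg (proj₁ u))
    (solve 2 (λ X Y → X := Y :* con0 :+ (:- X) :* (:- con1)) refl)
    (solve 2 (λ X Y → Y := Y :* con1 :+ (:- X) :* con0) refl)
    (solve 2 (λ X Y → con0 :* X :+ con1 :* Y := Y) refl)
    (solve 2 (λ X Y → (:- con1) :* X :+ con0 :* Y := :- X) refl)
  realFrameS : RealFrame frameS
  realFrameS = realFrame frameS 0# (- 1#) 1# 0# (λ X Y → - Y) (λ X Y → X)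
    (λ u → fromℤ-neg (proj₂ u)) (λ _ → refl)
    (solve 2 (λ X Y → X := (:- Y) :* con0 :+ X :* con1) refl)
    (solve 2 (λ X Y → Y := (:- Y) :* (:- con1) :+ X :* con0) refl)
    (solve 2 (λ X Y → con0 :* X :+ (:- con1) :* Y := :- Y) refl)
    (solve 2 (λ X Y → con1 :* X :+ con0 :* Y := X) refl)

module WedgeExploration (ℝ : RealField) (lem : ExcludedMiddle 0ℓ) (ox oy p₁ q₁ p₂ q₂ : RealField.Carrier ℝ)
  (d₁≢0 : NonZeroVec ℝ (p₁ , q₁)) (0<d₁·d₂ : RealField._<_ ℝ (RealField.0# ℝ) (dot ℝ (p₁ , q₁) (p₂ , q₂)))
  (connected : Connected ℝ (ox , oy) (p₁ , q₁) (p₂ , q₂)) where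
  open RealField ℝ
  open RealFieldProperties ℝ
  open Archimedean ℝ lem
  open WedgeGeometry ℝ ox oy p₁ q₁ p₂ q₂
  open RealFrames ℝ

  In : Node → Set
  In = InWedge ℝ (ox , oy) (p₁ , q₁) (p₂ , q₂)

  free : Node → Port → Bool
  free = freeBits ℝ lem (ox , oy) (p₁ , q₁) (p₂ , q₂)

  -- an edge leaving the wedge crosses H₁ or H₂, so it is walled off
  free⇒in : ∀ {u p} → In u → free u p ≡ true → In (go p u)
  free⇒in u∈ free≡ = dne λ pu∉ → true≢false (trans (sym free≡)
    (dec-false lem (λ unblocked → unblocked (inj₁ (u∈ , pu∉) , exit-meets-boundary d₁≢0 0<d₁·d₂ u∈ pu∉))))
    where
    true≢false : true ≢ false
    true≢false ()

  in⇒free : ∀ {u p} → In u → In (go p u) → free u p ≡ true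
  in⇒free u∈ pu∈ = dec-true lem λ { (inj₁ (_ , pu∉) , _) → pu∉ pu∈ ; (inj₂ (_ , u∉) , _) → u∉ u∈ }

  reach⇒path : ∀ {u v} → Reach ℝ (ox , oy) (p₁ , q₁) (p₂ , q₂) u v → Path In u v
  reach⇒path (here u∈)     = here u∈
  reach⇒path (step p u∈ r) = step p u∈ (reach⇒path r)

  module InFrame (fr : Frame) (rf : RealFrame fr)
    (0<ε·d₁ : 0# < dot ℝ (RealFrame.ε₁ rf , RealFrame.ε₂ rf) (p₁ , q₁))
    (0<ε·d₂ : 0# < dot ℝ (RealFrame.ε₁ rf , RealFrame.ε₂ rf) (p₂ , q₂)) where
    open Frame fr
    open RealFrame rf
    open Sweep fr

    column-convex : ∀ {u w x} → In u → In w → col x ≡ col u → col w ≡ col u →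
                    row u ℤ.≤ row x → row x ℤ.≤ row w → In x
    column-convex {u} {w} {x} u∈ w∈ colx colw u≤x x≤w =
      subst Region (sym (on-column colx))
        (region-interval (fromℤ-mono-≤ u≤x) (fromℤ-mono-≤ x≤w)
          (subst Region (on-column refl) u∈) (subst Region (on-column colw) w∈))
      where
      on-column : ∀ {v} → col v ≡ col u → embed ℝ v ≡
        (fromℤ ℝ (col u) * ε₁ + fromℤ ℝ (row v) * φ₁ , fromℤ ℝ (col u) * ε₂ + fromℤ ℝ (row v) * φ₂)
      on-column {v} same = cong₂ _,_
        (trans (embedˣ v) (cong (λ c → fromℤ ℝ c * ε₁ + fromℤ ℝ (row v) * φ₁) same))
        (trans (embedʸ v) (cong (λ c → fromℤ ℝ c * ε₂ + fromℤ ℝ (row v) * φ₂) same))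

    -- along a column the ε-coordinate is constant, so by domination the
    -- f-coordinate is bounded there, while it grows by 1 at each step of σ
    exits : (σ : Node → Node) (g : Node → ℤ) (f₁ f₂ : Carrier) →
            (∀ u → dot ℝ (f₁ , f₂) (embed ℝ u) ≡ fromℤ ℝ (g u)) →
            (∀ u → col (σ u) ≡ col u) → (∀ u → g (σ u) ≡ ℤ.suc (g u)) →
            ∀ {u} → In u → ∃[ k ] ¬ In (iterate σ u k)
    exits σ g f₁ f₂ f·embed col-σ g-σ {u} u∈ = dne λ stays → let k , M<k = archimedean (M - fromℤ ℝ (g u)) in
      ≤⇒≯ (bounded k (dne λ k∉ → stays (k , k∉))) (begin-strict
        M                          ≡⟨ solve 2 (λ M a → M := (M :- a) :+ a) refl M (fromℤ ℝ (g u)) ⟩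
        (M - fromℤ ℝ (g u)) + fromℤ ℝ (g u) <⟨ +-mono-< (fromℤ ℝ (g u)) M<k ⟩
        fromℕ ℝ k + fromℤ ℝ (g u)  ≡⟨ +-comm _ _ ⟩
        fromℤ ℝ (g u) + fromℕ ℝ k  ∎)
      where
      open ≤-Reasoning
      domination = dot-dominated 0<ε·d₁ 0<ε·d₂ f₁ f₂
      K = proj₁ domination
      M = dot ℝ (f₁ , f₂) (ox , oy) + (fromℤ ℝ (col u) - dot ℝ (ε₁ , ε₂) (ox , oy)) * K
      col-iterate : ∀ k {v} → col (iterate σ v k) ≡ col v
      col-iterate zero    = refl
      col-iterate (suc k) {v} = trans (col-iterate k) (col-σ v)
      g-iterate : ∀ k {v} → g (iterate σ v k) ≡ g v ℤ.+ ℤ.+ k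
      g-iterate zero    = sym (ℤ.+-identityʳ _)
      g-iterate (suc k) {v} = trans (g-iterate k) (trans (cong (λ c → c ℤ.+ ℤ.+ k) (g-σ v)) (sym (i+[1+k]≡suc[i]+k (g v) k)))
      bounded : ∀ k → In (iterate σ u k) → fromℤ ℝ (g u) + fromℕ ℝ k ≤ M
      bounded k k∈ = begin
        fromℤ ℝ (g u) + fromℕ ℝ k           ≡⟨ sym (trans (cong (fromℤ ℝ) (g-iterate k)) (fromℤ-+ (g u) (ℤ.+ k))) ⟩
        fromℤ ℝ (g v)                        ≡⟨ sym (f·embed v) ⟩
        dot ℝ (f₁ , f₂) (embed ℝ v)          ≡⟨ solve 2 (λ a b → a := b :+ (a :- b)) refl _ (dot ℝ (f₁ , f₂) (ox , oy)) ⟩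
        dot ℝ (f₁ , f₂) (ox , oy) + (dot ℝ (f₁ , f₂) (embed ℝ v) - dot ℝ (f₁ , f₂) (ox , oy))
                                             ≤⟨ +-monoʳ-≤ _ (proj₂ domination k∈) ⟩
        dot ℝ (f₁ , f₂) (ox , oy) + (dot ℝ (ε₁ , ε₂) (embed ℝ v) - dot ℝ (ε₁ , ε₂) (ox , oy)) * K
                                             ≡⟨ cong (λ c → dot ℝ (f₁ , f₂) (ox , oy) + (c - dot ℝ (ε₁ , ε₂) (ox , oy)) * K)
                                                  (trans (ε·embed v) (cong (fromℤ ℝ) (col-iterate k))) ⟩
        M                                    ∎
        where v = iterate σ u k

    sweepable : Sweepable In
    sweepable = record
      { column-convex = column-convex
      ; up-exits = exits (go up) row φ₁ φ₂ φ·embed col-up row-up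
      ; down-exits = exits (go down) (λ u → ℤ.- row u) (- φ₁) (- φ₂) -φ·embed col-down -row-down
      ; col-bounded-below = ℤ.- ℤ.+ n , λ u∈ → ℤ.≮⇒≥ λ col<-n → ≤⇒≯ (left-of-O u∈) (fromℤ-mono-< col<-n)
      ; connected = λ u∈ v∈ → reach⇒path (connected _ _ u∈ v∈)
      }
      where
      -φ·embed : ∀ u → dot ℝ (- φ₁ , - φ₂) (embed ℝ u) ≡ fromℤ ℝ (ℤ.- row u)
      -φ·embed u = trans (solve 4 (λ a b x y → (:- a) :* x :+ (:- b) :* y := :- (a :* x :+ b :* y)) refl φ₁ φ₂ _ _)
                         (trans (cong -_ (φ·embed u)) (sym (fromℤ-neg (row u))))
      -row-down : ∀ u → ℤ.- row (go down u) ≡ ℤ.suc (ℤ.- row u)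
      -row-down u = trans (cong ℤ.-_ (row-down u)) (-pred≡suc- (row u))
        where
        -pred≡suc- : ∀ i → ℤ.- (ℤ.-1ℤ ℤ.+ i) ≡ ℤ.1ℤ ℤ.+ ℤ.- i
        -pred≡suc- = solve-∀
      beyond-O = archimedean (- dot ℝ (ε₁ , ε₂) (ox , oy))
      n = proj₁ beyond-O
      left-of-O : ∀ {u} → In u → fromℤ ℝ (ℤ.- ℤ.+ n) ≤ fromℤ ℝ (col u)
      left-of-O {u} u∈ = begin
        fromℤ ℝ (ℤ.- ℤ.+ n)                ≡⟨ fromℤ-neg (ℤ.+ n) ⟩
        - fromℕ ℝ n                         <⟨ subst (- fromℕ ℝ n <_) (-‿involutive _) (neg-antimono-< (proj₂ beyond-O)) ⟩
        dot ℝ (ε₁ , ε₂) (ox , oy)           ≤⟨ dot-bounded-below 0<ε·d₁ 0<ε·d₂ u∈ ⟩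
        dot ℝ (ε₁ , ε₂) (embed ℝ u)         ≡⟨ ε·embed u ⟩
        fromℤ ℝ (col u)                     ∎
        where open ≤-Reasoning

    open Run In free (λ {u} {p} → free⇒in {u} {p}) (λ {u} {p} → in⇒free {u} {p}) sweepable

    run≡iterate : ∀ u n → run ℝ lem (ox , oy) (p₁ , q₁) (p₂ , q₂) automaton u n ≡ iterate next (descend , u) n
    run≡iterate u n = trans (run≡fold n) (iterate-is-fold (descend , u) next n)
      where
      run≡fold : ∀ n → run ℝ lem (ox , oy) (p₁ , q₁) (p₂ , q₂) automaton u n ≡ fold (descend , u) next n
      run≡fold zero    = refl
      run≡fold (suc n) = cong next (run≡fold n)

    automaton-explores : Explores ℝ lem (ox , oy) (p₁ , q₁) (p₂ , q₂) automaton
    automaton-explores u v u∈ v∈ =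
      let n , visits-v = explores u∈ v∈ in n , trans (cong proj₂ (run≡iterate u n)) visits-v

  exploring-automaton : ∃[ A ] Explores ℝ lem (ox , oy) (p₁ , q₁) (p₂ , q₂) A
  exploring-automaton with 0<x+y⇒0<x⊎0<y 0<d₁·d₂
  ... | inj₁ 0<p₁p₂ with 0<x*y⇒same-sign 0<p₁p₂
  ...   | inj₁ (0<p₁ , 0<p₂) = _ , InFrame.automaton-explores frameE realFrameE (along-E 0<p₁) (along-E 0<p₂)
    where
    along-E : ∀ {x y} → 0# < x → 0# < 1# * x + 0# * y
    along-E {x} {y} = subst (0# <_) (solve 2 (λ x y → x := con1 :* x :+ con0 :* y) refl x y)
  ...   | inj₂ (p₁<0 , p₂<0) = _ , InFrame.automaton-explores frameW realFrameW (along-W p₁<0) (along-W p₂<0)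
    where
    along-W : ∀ {x y} → x < 0# → 0# < (- 1#) * x + 0# * y
    along-W {x} {y} x<0 = subst (0# <_) (solve 2 (λ x y → :- x := (:- con1) :* x :+ con0 :* y) refl x y) (x<0⇒0<-x x<0)
  exploring-automaton | inj₂ 0<q₁q₂ with 0<x*y⇒same-sign 0<q₁q₂
  ...   | inj₁ (0<q₁ , 0<q₂) = _ , InFrame.automaton-explores frameN realFrameN (along-N 0<q₁) (along-N 0<q₂)
    where
    along-N : ∀ {x y} → 0# < y → 0# < 0# * x + 1# * y
    along-N {x} {y} = subst (0# <_) (solve 2 (λ x y → y := con0 :* x :+ con1 :* y) refl x y)
  ...   | inj₂ (q₁<0 , q₂<0) = _ , InFrame.automaton-explores frameS realFrameS (along-S q₁<0) (along-S q₂<0)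
    where
    along-S : ∀ {x y} → y < 0# → 0# < 0# * x + (- 1#) * y
    along-S {x} {y} y<0 = subst (0# <_) (solve 2 (λ x y → :- y := con0 :* x :+ (:- con1) :* y) refl x y) (x<0⇒0<-x y<0)

-- of the angle condition only 0 < d₁·d₂ is needed: the wedge is the cone spanned by d₁
-- and d₂ whichever of them bounds it first
proposition1 : (ℝ : RealField) (lem : ExcludedMiddle 0ℓ) (O d₁ d₂ : Point ℝ) →
    NonZeroVec ℝ d₁ → NonZeroVec ℝ d₂ → Acute ℝ d₁ d₂ → Connected ℝ O d₁ d₂ →
    ∃[ A ] Explores ℝ lem O d₁ d₂ A
proposition1 ℝ lem (ox , oy) (p₁ , q₁) (p₂ , q₂) d₁≢0 _ (_ , 0<d₁·d₂) connected =
  WedgeExploration.exploring-automaton ℝ lem ox oy p₁ q₁ p₂ q₂ d₁≢0 0<d₁·d₂ connected
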